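{- Let $k>a\ge1$ be integers. Then $$D^{\mathrm{sl},\ell}_{k,a}(x,y;q):=\sum_{\lambda\in\mathcal{D}_{k,a}}x^{\mathrm{sl}_{k,a}(\lambda)}y^{\ell(\lambda)}q^{|\lambda|}=\sum_{i,j\ge0}\frac{x^iy^{ai+kj}q^{i^2\binom{a+1}{2}+akij+\binom{kj+1}{2}}}{(q^a;q^a)_i(q^k;q^k)_j}.$$
   Context: $(a;q)_n=(1-a)(1-aq)\cdots(1-aq^{n-1})$, $(a;q)_0=1$. For a partition, $|\lambda|$ is the sum of its parts and $\ell(\lambda)$ the number of parts. A sequence of a strict partition (distinct parts) is a maximal string of consecutive integers all of which are parts. $\mathcal{D}_{k,a}$ is the set of strict partitions (including the empty one) all of whose sequences have length congruent to $0$ or $a$ modulo $k$; for $\lambda\in\mathcal{D}_{k,a}$, $\mathrm{sl}_{k,a}(\lambda)$ is the number of sequences of $\lambda$ whose length is congruent to $a$ modulo $k$. -}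

module Defs where

open import Data.Nat using (ℕ; zero; suc; _+_; _*_; _∸_; _<_; _≤ᵇ_; _≡ᵇ_; NonZero)
open import Data.Nat.DivMod using (_%_)
open import Data.Nat.Combinatorics using (_C_)
open import Data.Integer using (ℤ; +_) renaming (_+_ to _+ℤ_; _*_ to _*ℤ_; _-_ to _-ℤ_; -_ to -ℤ_)
open import Data.Bool using (Bool; true; false; if_then_else_; _∧_; _∨_; T)
open import Data.List using (List; []; _∷_; length; filterᵇ)
open import Data.Nat.ListAction using (sum)
open import Data.List.Relation.Unary.All using (All)
open import Data.List.Relation.Unary.Linked using (Linked)
open import Data.Product using (Σ; _×_)
open import Relation.Binary.PropositionalEquality using (_≡_)

StrictPartition : List ℕ → Set
StrictPartition ps = Linked (λ x y → y < x) ps × All (λ p → 0 < p) ps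

-- Lengths of the sequences (maximal runs of consecutive integers) of a
-- strictly decreasing list, in order.
runsGo : ℕ → ℕ → List ℕ → List ℕ
runsGo prev len [] = len ∷ []
runsGo prev len (p ∷ ps) =
  if suc p ≡ᵇ prev then runsGo p (suc len) ps else len ∷ runsGo p 1 ps

seqLengths : List ℕ → List ℕ
seqLengths [] = []
seqLengths (p ∷ ps) = runsGo p 1 ps

allᵇ : (ℕ → Bool) → List ℕ → Bool
allᵇ f [] = true
allᵇ f (x ∷ xs) = f x ∧ allᵇ f xs

inD : (k a : ℕ) .{{_ : NonZero k}} → List ℕ → Bool
inD k a ps = allᵇ (λ m → (m % k ≡ᵇ 0) ∨ (m % k ≡ᵇ a % k)) (seqLengths ps)

sl : (k a : ℕ) .{{_ : NonZero k}} → List ℕ → ℕ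
sl k a ps = length (filterᵇ (λ m → m % k ≡ᵇ a % k) (seqLengths ps))

DPart : (k a : ℕ) .{{_ : NonZero k}} → ℕ → ℕ → ℕ → Set
DPart k a s l n =
  Σ (List ℕ) λ ps → StrictPartition ps × T (inD k a ps)
    × (sl k a ps ≡ s) × (length ps ≡ l) × (sum ps ≡ n)

Series : Set
Series = ℕ → ℤ

sumTo : ℕ → (ℕ → ℤ) → ℤ
sumTo zero f = f 0
sumTo (suc n) f = sumTo n f +ℤ f (suc n)

_⊛_ : Series → Series → Series
(f ⊛ g) n = sumTo n (λ t → f t *ℤ g (n ∸ t))

oneS : Series
oneS n = if n ≡ᵇ 0 then + 1 else + 0

mono : ℕ → Series
mono c n = if n ≡ᵇ c then + 1 else + 0

_−S_ : Series → Series → Series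
(f −S g) n = f n -ℤ g n

poch : ℕ → ℕ → Series
poch c zero = oneS
poch c (suc i) = poch c i ⊛ (oneS −S mono (c * suc i))

-- Multiplicative inverse of a series f with constant term 1:
-- b 0 = 1,  b (n+1) = - Σ_{t=1}^{n+1} f t * b (n+1-t).
-- invUpTo f n is correct at all indices ≤ n.
invUpTo : Series → ℕ → Series
invUpTo f zero m = + 1
invUpTo f (suc n) m =
  if m ≤ᵇ n then invUpTo f n m
  else -ℤ sumTo n (λ t → f (suc t) *ℤ invUpTo f n (n ∸ t))

inv : Series → Series
inv f n = invUpTo f n n

term : (k a i j : ℕ) → Series
term k a i j =
  mono (i * i * (suc a C 2) + a * k * i * j + (suc (k * j) C 2))
    ⊛ inv (poch a i ⊛ poch k j)

-- Coefficient of x^s y^l q^n in  Σ_{i,j ≥ 0} x^i y^{ai+kj} term(i,j):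
-- only i = s contributes, and j ≤ l necessarily.
rhsCoeff : (k a s l n : ℕ) → ℤ
rhsCoeff k a s l n =
  sumTo l (λ j → if a * s + k * j ≡ᵇ l then term k a s j n else + 0)

module Submission where

-- Both sides satisfy the same recurrence in the number l ≥ 1 of parts.
--
-- Combinatorially, list the parts of a partition in increasing order and look at its initial
-- run 1, 2, …, r.  If r = 0, subtracting 1 from every part lowers the size by l.  If r = a,
-- deleting the run and lowering the other parts by a + 1 removes one sequence of length ≡ a.
-- Otherwise r ≡ 0 or a (mod k) and a < k force r ≥ k, and deleting 1, …, k and lowering the
-- other parts by k changes no sequence length modulo k.
--
-- Analytically, with Q(i,j) = 1/((q^a;q^a)_i (q^k;q^k)_j), peeling off one factor gives
-- Q(i,j) = Q(i-1,j) + q^{ai} Q(i,j) and Q(i,j) = Q(i,j-1) + q^{kj} Q(i,j).  The coefficient of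
-- x^s y^l q^n on the right, which vanishes unless l = as + kj, therefore obeys the same
-- three-term recurrence, and strong induction on n yields the count with an explicit bijection.


open import Defs
open import Data.Bool using (Bool; true; false; if_then_else_; T; _∧_; _∨_; T?)
open import Data.Bool.Properties using (∧-assoc; ∧-comm; ∧-identityʳ; T-irrelevant; T-∧; T-∨)
open import Data.Empty using (⊥-elim)
open import Data.Fin using (Fin; zero)
open import Data.Fin.Properties using (+↔⊎)
open import Data.Integer using (ℤ; +_) renaming (_+_ to _+ℤ_; _*_ to _*ℤ_; _-_ to _-ℤ_; -_ to -ℤ_)
import Data.Integer.Properties as ℤ
open import Algebra.Properties.AbelianGroup ℤ.+-0-abelianGroup using (inverseˡ-unique)
open import Data.Integer.Tactic.RingSolver using (solve-∀)
open import Data.List using (List; []; _∷_; _++_; length; map; drop; filterᵇ; reverse; reverseAcc)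
open import Data.List.Properties using (reverse-++; unfold-reverse; reverse-involutive; length-reverse; length-++; length-map)
open import Data.List.Relation.Binary.Permutation.Propositional.Properties using (↭-length; filter-↭; ↭-reverse)
open import Data.List.Relation.Unary.All using (All; []; _∷_)
import Data.List.Relation.Unary.All as All
open import Data.List.Relation.Unary.Linked using (Linked; []; [-]; _∷_)
import Data.List.Relation.Unary.Linked as Linked
import Data.List.Relation.Unary.Linked.Properties as Linked
open import Data.List.Relation.Unary.Linked.Properties using (Linked⇒All)
open import Data.Nat using (ℕ; zero; suc; z<s; _+_; _*_; _∸_; _≤_; _<_; _>_; z≤n; s≤s; _≤ᵇ_; _≡ᵇ_; NonZero; _≟_; _≤?_)
open import Data.Nat.Combinatorics using (_C_; nC1≡n; nCk+nC[k+1]≡[n+1]C[k+1])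
open import Data.Nat.DivMod using (_%_; m<n⇒m%n≡m; [m+n]%n≡m%n; n%n≡0)
open import Data.Nat.Induction using (<-rec)
open import Data.Nat.ListAction using (sum)
open import Data.Nat.ListAction.Properties using (sum-↭; sum-++)
open import Data.Nat.Properties
  using (≤-refl; ≤-reflexive; ≤-trans; ≤-pred; <-trans; ≤-<-trans; <-≤-trans; <⇒≤; <⇒≢; ≤∧≢⇒<; ≰⇒>;
         n≮n; m≤n⇒m≤1+n; n≤1+n; m≤m+n; m≤n+m; m≤n*m; ≤⇒≤ᵇ; ≤ᵇ⇒≤; ≡ᵇ⇒≡; ≡⇒≡ᵇ;
         <-irrelevant; ≡-irrelevant; 0≢1+n; 1+n≢0;
         +-comm; +-assoc; +-suc; +-identityʳ; +-cancelˡ-≡; +-monoʳ-≤; +-monoʳ-<; +-cancelˡ-<;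
         *-comm; *-suc; *-zeroʳ; *-identityˡ; *-distribˡ-+; *-distribʳ-+; *-cancelˡ-≡;
         m∸n≤m; m∸[m∸n]≡n; +-∸-assoc; m+[n∸m]≡n; m+n∸m≡n; m+n∸n≡m; ∸-+-assoc; ∸-monoˡ-≤; ∸-monoʳ-<;
         n∸n≡0; anyUpTo?; +-commutativeSemigroup)
open import Algebra.Properties.CommutativeSemigroup +-commutativeSemigroup
  using () renaming (x∙yz≈y∙xz to x+[y+z]≡y+[x+z])
open import Data.Nat.Tactic.RingSolver renaming (solve-∀ to ℕ-solve-∀)
open import Data.Product using (Σ; ∃; _,_; _×_; proj₁; proj₂)
open import Data.Sum using (_⊎_; inj₁; inj₂)
open import Data.Sum.Function.Propositional using (_⊎-↔_)
open import Function using (_∘_; flip)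
open import Function.Bundles using (_↔_; mk↔ₛ′; Equivalence)
open import Function.Properties.Inverse using (↔-trans; ↔-sym)
open import Relation.Nullary using (¬_; Dec; yes; no; contradiction)
open import Relation.Nullary.Decidable using (map′)
open import Relation.Binary.PropositionalEquality
open ≡-Reasoning

if-true : ∀ {A : Set} {b} {x y : A} → T b → (if b then x else y) ≡ x
if-true {b = true} _ = refl

if-false : ∀ {A : Set} {b} {x y : A} → ¬ T b → (if b then x else y) ≡ y
if-false {b = true} ¬t = ⊥-elim (¬t _)
if-false {b = false} _ = refl

≡ᵇ-refl : ∀ n → (n ≡ᵇ n) ≡ true
≡ᵇ-refl zero = refl
≡ᵇ-refl (suc n) = ≡ᵇ-refl n

-- Finite sums and formal power series

sumTo-cong : ∀ n {f g : ℕ → ℤ} → (∀ t → t ≤ n → f t ≡ g t) → sumTo n f ≡ sumTo n g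
sumTo-cong zero h = h 0 z≤n
sumTo-cong (suc n) h = cong₂ _+ℤ_ (sumTo-cong n (λ t t≤n → h t (m≤n⇒m≤1+n t≤n))) (h (suc n) ≤-refl)

sumTo-unfoldˡ : ∀ n (f : ℕ → ℤ) → sumTo (suc n) f ≡ f 0 +ℤ sumTo n (λ t → f (suc t))
sumTo-unfoldˡ zero f = refl
sumTo-unfoldˡ (suc n) f = begin
  sumTo (suc n) f +ℤ f (suc (suc n))                    ≡⟨ cong (_+ℤ f (suc (suc n))) (sumTo-unfoldˡ n f) ⟩
  (f 0 +ℤ sumTo n (λ t → f (suc t))) +ℤ f (suc (suc n)) ≡⟨ ℤ.+-assoc (f 0) _ _ ⟩
  f 0 +ℤ (sumTo n (λ t → f (suc t)) +ℤ f (suc (suc n))) ∎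

sumTo-zero : ∀ n {f : ℕ → ℤ} → (∀ t → t ≤ n → f t ≡ + 0) → sumTo n f ≡ + 0
sumTo-zero zero h = h 0 z≤n
sumTo-zero (suc n) h = cong₂ _+ℤ_ (sumTo-zero n (λ t t≤n → h t (m≤n⇒m≤1+n t≤n))) (h (suc n) ≤-refl)

sumTo-singleton : ∀ n c {f : ℕ → ℤ} → c ≤ n → (∀ t → t ≤ n → t ≢ c → f t ≡ + 0) → sumTo n f ≡ f c
sumTo-singleton zero .zero z≤n h = refl
sumTo-singleton (suc n) c {f} c≤1+n h with c ≟ suc n
... | yes refl = trans (cong (_+ℤ f (suc n)) rest-zero) (ℤ.+-identityˡ _)
  where rest-zero = sumTo-zero n (λ t t≤n → h t (m≤n⇒m≤1+n t≤n) (<⇒≢ (s≤s t≤n)))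
... | no c≢1+n = trans (cong₂ _+ℤ_ rest last-zero) (ℤ.+-identityʳ _)
  where
  rest = sumTo-singleton n c (≤-pred (≤∧≢⇒< c≤1+n c≢1+n)) (λ t t≤n → h t (m≤n⇒m≤1+n t≤n))
  last-zero = h (suc n) ≤-refl (λ e → c≢1+n (sym e))

sumTo-distrib-+ : ∀ n (f g : ℕ → ℤ) → sumTo n (λ t → f t +ℤ g t) ≡ sumTo n f +ℤ sumTo n g
sumTo-distrib-+ zero f g = refl
sumTo-distrib-+ (suc n) f g =
  trans (cong (_+ℤ (f (suc n) +ℤ g (suc n))) (sumTo-distrib-+ n f g)) (middle-swap (sumTo n f) (sumTo n g) (f (suc n)) (g (suc n)))
  where
  middle-swap : ∀ (w x y z : ℤ) → (w +ℤ x) +ℤ (y +ℤ z) ≡ (w +ℤ y) +ℤ (x +ℤ z)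
  middle-swap = solve-∀

sumTo-neg : ∀ n (f : ℕ → ℤ) → sumTo n (λ t → -ℤ f t) ≡ -ℤ sumTo n f
sumTo-neg zero f = refl
sumTo-neg (suc n) f =
  trans (cong (_+ℤ (-ℤ f (suc n))) (sumTo-neg n f)) (sym (ℤ.neg-distrib-+ (sumTo n f) (f (suc n))))

*-distribˡ-sumTo : ∀ n (x : ℤ) (f : ℕ → ℤ) → x *ℤ sumTo n f ≡ sumTo n (λ t → x *ℤ f t)
*-distribˡ-sumTo zero x f = refl
*-distribˡ-sumTo (suc n) x f =
  trans (ℤ.*-distribˡ-+ x (sumTo n f) (f (suc n))) (cong (_+ℤ (x *ℤ f (suc n))) (*-distribˡ-sumTo n x f))

*-distribʳ-sumTo : ∀ n (x : ℤ) (f : ℕ → ℤ) → sumTo n f *ℤ x ≡ sumTo n (λ t → f t *ℤ x)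
*-distribʳ-sumTo zero x f = refl
*-distribʳ-sumTo (suc n) x f =
  trans (ℤ.*-distribʳ-+ x (sumTo n f) (f (suc n))) (cong (_+ℤ (f (suc n) *ℤ x)) (*-distribʳ-sumTo n x f))

sumTo-reverse : ∀ n (f : ℕ → ℤ) → sumTo n f ≡ sumTo n (λ t → f (n ∸ t))
sumTo-reverse zero f = refl
sumTo-reverse (suc n) f = begin
  sumTo (suc n) f
    ≡⟨ sumTo-unfoldˡ n f ⟩
  f 0 +ℤ sumTo n (λ t → f (suc t))
    ≡⟨ cong (f 0 +ℤ_) (sumTo-reverse n (λ t → f (suc t))) ⟩
  f 0 +ℤ sumTo n (λ t → f (suc (n ∸ t)))
    ≡⟨ ℤ.+-comm (f 0) _ ⟩
  sumTo n (λ t → f (suc (n ∸ t))) +ℤ f 0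
    ≡⟨ cong₂ _+ℤ_ (sumTo-cong n (λ t t≤n → cong f (sym (+-∸-assoc 1 t≤n)))) (cong f (sym (n∸n≡0 n))) ⟩
  sumTo (suc n) (λ t → f (suc n ∸ t)) ∎

sumTo-exchange : ∀ n (F : ℕ → ℕ → ℤ) →
  sumTo n (λ t → sumTo t (λ u → F u t)) ≡ sumTo n (λ u → sumTo (n ∸ u) (λ v → F u (u + v)))
sumTo-exchange zero F = refl
sumTo-exchange (suc n) F = begin
  sumTo n (λ t → sumTo t (λ u → F u t)) +ℤ sumTo (suc n) (λ u → F u (suc n))
    ≡⟨ cong (_+ℤ sumTo (suc n) (λ u → F u (suc n))) (sumTo-exchange n F) ⟩
  A +ℤ (S +ℤ F (suc n) (suc n))
    ≡⟨ sym (ℤ.+-assoc A S _) ⟩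
  (A +ℤ S) +ℤ F (suc n) (suc n)
    ≡⟨ cong₂ _+ℤ_ (sym (sumTo-distrib-+ n _ _)) (cong (F (suc n)) (sym (+-identityʳ (suc n)))) ⟩
  sumTo n (λ u → sumTo (n ∸ u) (λ v → F u (u + v)) +ℤ F u (suc n)) +ℤ F (suc n) (suc n + 0)
    ≡⟨ cong₂ _+ℤ_ (sumTo-cong n extend-row) (cong (λ z → sumTo z (λ v → F (suc n) (suc n + v))) (sym (n∸n≡0 n))) ⟩
  sumTo (suc n) (λ u → sumTo (suc n ∸ u) (λ v → F u (u + v))) ∎
  where
  A = sumTo n (λ u → sumTo (n ∸ u) (λ v → F u (u + v)))
  S = sumTo n (λ u → F u (suc n))
  extend-row : ∀ u → u ≤ n →
    sumTo (n ∸ u) (λ v → F u (u + v)) +ℤ F u (suc n) ≡ sumTo (suc n ∸ u) (λ v → F u (u + v))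
  extend-row u u≤n = begin
    sumTo (n ∸ u) (λ v → F u (u + v)) +ℤ F u (suc n)
      ≡⟨ cong (λ z → sumTo (n ∸ u) (λ v → F u (u + v)) +ℤ F u z) (sym u+[1+n∸u]≡1+n) ⟩
    sumTo (suc (n ∸ u)) (λ v → F u (u + v))
      ≡⟨ cong (λ z → sumTo z (λ v → F u (u + v))) (sym (+-∸-assoc 1 u≤n)) ⟩
    sumTo (suc n ∸ u) (λ v → F u (u + v)) ∎
    where
    u+[1+n∸u]≡1+n : u + suc (n ∸ u) ≡ suc n
    u+[1+n∸u]≡1+n = trans (+-suc u (n ∸ u)) (cong suc (m+[n∸m]≡n u≤n))

infix 4 _≈_
_≈_ : Series → Series → Set
f ≈ g = ∀ n → f n ≡ g n

_+S_ : Series → Series → Series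
(f +S g) n = f n +ℤ g n

shift : ℕ → Series → Series
shift c f n = if c ≤ᵇ n then f (n ∸ c) else + 0

⊛-cong : ∀ {f f′ g g′} → f ≈ f′ → g ≈ g′ → f ⊛ g ≈ f′ ⊛ g′
⊛-cong f≈f′ g≈g′ n = sumTo-cong n (λ t _ → cong₂ _*ℤ_ (f≈f′ t) (g≈g′ (n ∸ t)))

⊛-comm : ∀ f g → f ⊛ g ≈ g ⊛ f
⊛-comm f g n = trans (sumTo-reverse n _) (sumTo-cong n swap)
  where
  swap : ∀ t → t ≤ n → f (n ∸ t) *ℤ g (n ∸ (n ∸ t)) ≡ g t *ℤ f (n ∸ t)
  swap t t≤n = trans (cong (λ z → f (n ∸ t) *ℤ g z) (m∸[m∸n]≡n t≤n)) (ℤ.*-comm (f (n ∸ t)) (g t))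

⊛-assoc : ∀ f g h → (f ⊛ g) ⊛ h ≈ f ⊛ (g ⊛ h)
⊛-assoc f g h n = begin
  sumTo n (λ t → sumTo t (λ u → f u *ℤ g (t ∸ u)) *ℤ h (n ∸ t))
    ≡⟨ sumTo-cong n (λ t _ → *-distribʳ-sumTo t (h (n ∸ t)) _) ⟩
  sumTo n (λ t → sumTo t (λ u → f u *ℤ g (t ∸ u) *ℤ h (n ∸ t)))
    ≡⟨ sumTo-exchange n (λ u t → f u *ℤ g (t ∸ u) *ℤ h (n ∸ t)) ⟩
  sumTo n (λ u → sumTo (n ∸ u) (λ v → f u *ℤ g (u + v ∸ u) *ℤ h (n ∸ (u + v))))
    ≡⟨ sumTo-cong n (λ u _ → trans (sumTo-cong (n ∸ u) (λ v _ → reindex u v)) (sym (*-distribˡ-sumTo (n ∸ u) (f u) _))) ⟩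
  sumTo n (λ u → f u *ℤ sumTo (n ∸ u) (λ v → g v *ℤ h (n ∸ u ∸ v))) ∎
  where
  reindex : ∀ u v → f u *ℤ g (u + v ∸ u) *ℤ h (n ∸ (u + v)) ≡ f u *ℤ (g v *ℤ h (n ∸ u ∸ v))
  reindex u v = trans (cong₂ (λ x y → f u *ℤ g x *ℤ h y) (m+n∸m≡n u v) (sym (∸-+-assoc n u v)))
                      (ℤ.*-assoc (f u) _ _)

⊛-distribʳ-−S : ∀ f g h → (f −S g) ⊛ h ≈ (f ⊛ h) −S (g ⊛ h)
⊛-distribʳ-−S f g h n = begin
  sumTo n (λ t → (f t -ℤ g t) *ℤ h (n ∸ t))
    ≡⟨ sumTo-cong n (λ t _ → distrib t) ⟩
  sumTo n (λ t → f t *ℤ h (n ∸ t) +ℤ -ℤ (g t *ℤ h (n ∸ t)))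
    ≡⟨ sumTo-distrib-+ n _ _ ⟩
  (f ⊛ h) n +ℤ sumTo n (λ t → -ℤ (g t *ℤ h (n ∸ t)))
    ≡⟨ cong ((f ⊛ h) n +ℤ_) (sumTo-neg n _) ⟩
  (f ⊛ h) n -ℤ (g ⊛ h) n ∎
  where
  distrib : ∀ t → (f t -ℤ g t) *ℤ h (n ∸ t) ≡ f t *ℤ h (n ∸ t) +ℤ -ℤ (g t *ℤ h (n ∸ t))
  distrib t = trans (ℤ.*-distribʳ-+ (h (n ∸ t)) (f t) (-ℤ g t))
                    (cong (f t *ℤ h (n ∸ t) +ℤ_) (sym (ℤ.neg-distribˡ-* (g t) (h (n ∸ t)))))

mono-⊛ : ∀ c f → mono c ⊛ f ≈ shift c f
mono-⊛ c f n with c ≤? n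
... | yes c≤n = begin
  sumTo n (λ t → mono c t *ℤ f (n ∸ t)) ≡⟨ sumTo-singleton n c c≤n off-c ⟩
  mono c c *ℤ f (n ∸ c)                 ≡⟨ cong (_*ℤ f (n ∸ c)) (if-true (≡⇒≡ᵇ c c refl)) ⟩
  + 1 *ℤ f (n ∸ c)                      ≡⟨ ℤ.*-identityˡ (f (n ∸ c)) ⟩
  f (n ∸ c)                             ≡⟨ sym (if-true (≤⇒≤ᵇ c≤n)) ⟩
  shift c f n                           ∎
  where
  off-c : ∀ t → t ≤ n → t ≢ c → mono c t *ℤ f (n ∸ t) ≡ + 0
  off-c t _ t≢c = cong (_*ℤ f (n ∸ t)) (if-false (t≢c ∘ ≡ᵇ⇒≡ t c))
... | no c≰n = trans (sumTo-zero n below-c) (sym (if-false (c≰n ∘ ≤ᵇ⇒≤ c n)))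
  where
  below-c : ∀ t → t ≤ n → mono c t *ℤ f (n ∸ t) ≡ + 0
  below-c t t≤n = cong (_*ℤ f (n ∸ t)) (if-false (λ t≡c → c≰n (subst (_≤ n) (≡ᵇ⇒≡ t c t≡c) t≤n)))

oneS-⊛ : ∀ f → oneS ⊛ f ≈ f
oneS-⊛ = mono-⊛ 0

[1−q^c]-⊛ : ∀ c f → (oneS −S mono c) ⊛ f ≈ f −S shift c f
[1−q^c]-⊛ c f n = trans (⊛-distribʳ-−S oneS (mono c) f n) (cong₂ _-ℤ_ (oneS-⊛ f n) (mono-⊛ c f n))

shift-≡ : ∀ {c d} f n → c ≡ d → shift c f n ≡ shift d f n
shift-≡ f n refl = refl

shift-zero : ∀ c n → shift c (λ _ → + 0) n ≡ + 0
shift-zero c n with c ≤ᵇ n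
... | true = refl
... | false = refl

shift-cong : ∀ c {f g} → f ≈ g → shift c f ≈ shift c g
shift-cong c f≈g n with c ≤ᵇ n
... | true = f≈g (n ∸ c)
... | false = refl

shift-+S : ∀ c f g → shift c (f +S g) ≈ shift c f +S shift c g
shift-+S c f g n with c ≤ᵇ n
... | true = refl
... | false = refl

shift-shift : ∀ c d f → shift c (shift d f) ≈ shift (d + c) f
shift-shift c d f n with c ≤? n
... | no c≰n =
  trans (if-false (c≰n ∘ ≤ᵇ⇒≤ c n)) (sym (if-false (c≰n ∘ ≤-trans (m≤n+m c d) ∘ ≤ᵇ⇒≤ (d + c) n)))
... | yes c≤n with d ≤? n ∸ c
...   | yes d≤n∸c = begin
  shift c (shift d f) n ≡⟨ if-true (≤⇒≤ᵇ c≤n) ⟩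
  shift d f (n ∸ c)     ≡⟨ if-true (≤⇒≤ᵇ d≤n∸c) ⟩
  f (n ∸ c ∸ d)         ≡⟨ cong f (trans (∸-+-assoc n c d) (cong (n ∸_) (+-comm c d))) ⟩
  f (n ∸ (d + c))       ≡⟨ sym (if-true (≤⇒≤ᵇ d+c≤n)) ⟩
  shift (d + c) f n     ∎
  where
  d+c≤n : d + c ≤ n
  d+c≤n = subst (_≤ n) (+-comm c d) (subst (c + d ≤_) (m+[n∸m]≡n c≤n) (+-monoʳ-≤ c d≤n∸c))
...   | no d≰n∸c =
  trans (if-true (≤⇒≤ᵇ c≤n)) (trans (if-false (d≰n∸c ∘ ≤ᵇ⇒≤ d (n ∸ c))) (sym (if-false d+c≰n)))
  where
  d+c≰n : ¬ T (d + c ≤ᵇ n)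
  d+c≰n t = d≰n∸c (subst (_≤ n ∸ c) (m+n∸n≡m d c) (∸-monoˡ-≤ c (≤ᵇ⇒≤ (d + c) n t)))

module _ (f : Series) where

  invUpTo-stable : ∀ n m → m ≤ n → invUpTo f n m ≡ inv f m
  invUpTo-stable zero .zero z≤n = refl
  invUpTo-stable (suc n) m m≤1+n with m ≤? n
  ... | yes m≤n = trans (if-true (≤⇒≤ᵇ m≤n)) (invUpTo-stable n m m≤n)
  ... | no m≰n with m ≟ suc n
  ...   | yes refl = refl
  ...   | no m≢1+n = ⊥-elim (m≰n (≤-pred (≤∧≢⇒< m≤1+n m≢1+n)))

  inv-suc : ∀ n → inv f (suc n) ≡ -ℤ sumTo n (λ t → f (suc t) *ℤ inv f (n ∸ t))
  inv-suc n = trans (if-false (n≮n n ∘ ≤ᵇ⇒≤ (suc n) n))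
                    (cong -ℤ_ (sumTo-cong n (λ t _ → cong (f (suc t) *ℤ_) (invUpTo-stable n (n ∸ t) (m∸n≤m n t)))))

  ⊛-unfold-suc : f 0 ≡ + 1 → ∀ g m → (f ⊛ g) (suc m) ≡ g (suc m) +ℤ sumTo m (λ t → f (suc t) *ℤ g (m ∸ t))
  ⊛-unfold-suc f0≡1 g m = begin
    (f ⊛ g) (suc m)        ≡⟨ sumTo-unfoldˡ m _ ⟩
    f 0 *ℤ g (suc m) +ℤ S  ≡⟨ cong (λ z → z *ℤ g (suc m) +ℤ S) f0≡1 ⟩
    + 1 *ℤ g (suc m) +ℤ S  ≡⟨ cong (_+ℤ S) (ℤ.*-identityˡ (g (suc m))) ⟩
    g (suc m) +ℤ S         ∎
    where S = sumTo m (λ t → f (suc t) *ℤ g (m ∸ t))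

  ⊛-inverseʳ : f 0 ≡ + 1 → f ⊛ inv f ≈ oneS
  ⊛-inverseʳ f0≡1 zero = cong (_*ℤ + 1) f0≡1
  ⊛-inverseʳ f0≡1 (suc m) = begin
    (f ⊛ inv f) (suc m)    ≡⟨ ⊛-unfold-suc f0≡1 (inv f) m ⟩
    inv f (suc m) +ℤ S     ≡⟨ cong (_+ℤ S) (inv-suc m) ⟩
    -ℤ S +ℤ S              ≡⟨ ℤ.+-inverseˡ S ⟩
    + 0                    ∎
    where S = sumTo m (λ t → f (suc t) *ℤ inv f (m ∸ t))

  inv-unique : ∀ g → f 0 ≡ + 1 → f ⊛ g ≈ oneS → inv f ≈ g
  inv-unique g f0≡1 fg≈1 = <-rec (λ n → inv f n ≡ g n) step
    where
    step : ∀ n → (∀ {m} → m < n → inv f m ≡ g m) → inv f n ≡ g n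
    step zero _ = sym (trans (sym (ℤ.*-identityˡ (g 0))) (trans (cong (_*ℤ g 0) (sym f0≡1)) (fg≈1 0)))
    step (suc m) ih = begin
      inv f (suc m)
        ≡⟨ inv-suc m ⟩
      -ℤ sumTo m (λ t → f (suc t) *ℤ inv f (m ∸ t))
        ≡⟨ cong -ℤ_ (sumTo-cong m (λ t _ → cong (f (suc t) *ℤ_) (ih (s≤s (m∸n≤m m t))))) ⟩
      -ℤ S
        ≡⟨ sym (inverseˡ-unique _ _ (trans (sym (⊛-unfold-suc f0≡1 g m)) (fg≈1 (suc m)))) ⟩
      g (suc m) ∎
      where
      S = sumTo m (λ t → f (suc t) *ℤ g (m ∸ t))

inv-⊛[1−q^c] : ∀ c P P′ → P 0 ≡ + 1 → P′ 0 ≡ + 1 → P′ ≈ P ⊛ (oneS −S mono c) →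
               inv P′ ≈ inv P +S shift c (inv P′)
inv-⊛[1−q^c] c P P′ P0≡1 P′0≡1 P′≈P[1−q^c] n = begin
  inv P′ n
    ≡⟨ x≡[x-y]+y (inv P′ n) (shift c (inv P′) n) ⟩
  (inv P′ n -ℤ shift c (inv P′) n) +ℤ shift c (inv P′) n
    ≡⟨ cong (_+ℤ shift c (inv P′) n) (sym (inv-unique P (inv P′ −S shift c (inv P′)) P0≡1 P⊛g≈1 n)) ⟩
  inv P n +ℤ shift c (inv P′) n ∎
  where
  x≡[x-y]+y : ∀ x y → x ≡ (x -ℤ y) +ℤ y
  x≡[x-y]+y = solve-∀
  P⊛g≈1 : P ⊛ (inv P′ −S shift c (inv P′)) ≈ oneS
  P⊛g≈1 m = begin
    (P ⊛ (inv P′ −S shift c (inv P′))) m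
      ≡⟨ ⊛-cong {P} (λ _ → refl) (λ t → sym ([1−q^c]-⊛ c (inv P′) t)) m ⟩
    (P ⊛ ((oneS −S mono c) ⊛ inv P′)) m
      ≡⟨ sym (⊛-assoc P (oneS −S mono c) (inv P′) m) ⟩
    ((P ⊛ (oneS −S mono c)) ⊛ inv P′) m
      ≡⟨ ⊛-cong {g = inv P′} (λ t → sym (P′≈P[1−q^c] t)) (λ _ → refl) m ⟩
    (P′ ⊛ inv P′) m
      ≡⟨ ⊛-inverseʳ P′ P′0≡1 m ⟩
    oneS m ∎

-- The coefficients of the right-hand side

poch-0 : ∀ c i → poch (suc c) i 0 ≡ + 1
poch-0 c zero = refl
poch-0 c (suc i) rewrite poch-0 c i = refl

triangle : ℕ → ℕ
triangle x = suc x C 2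

triangle-suc : ∀ x → triangle (suc x) ≡ suc x + triangle x
triangle-suc x = trans (sym (nCk+nC[k+1]≡[n+1]C[k+1] (suc x) 1)) (cong (_+ triangle x) (nC1≡n (suc x)))

triangle-+ : ∀ x y → triangle (x + y) ≡ triangle x + triangle y + x * y
triangle-+ zero y = sym (+-identityʳ (triangle y))
triangle-+ (suc x) y = begin
  triangle (suc (x + y))                            ≡⟨ triangle-suc (x + y) ⟩
  suc (x + y) + triangle (x + y)                    ≡⟨ cong (λ z → suc (x + y) + z) (triangle-+ x y) ⟩
  suc (x + y) + (triangle x + triangle y + x * y)   ≡⟨ rearrange x y (triangle x) (triangle y) ⟩
  (suc x + triangle x) + triangle y + suc x * y     ≡⟨ cong (λ z → z + triangle y + suc x * y) (sym (triangle-suc x)) ⟩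
  triangle (suc x) + triangle y + suc x * y         ∎
  where
  rearrange : ∀ x y A B → suc (x + y) + (A + B + x * y) ≡ (suc x + A) + B + suc x * y
  rearrange = ℕ-solve-∀

2*triangle : ∀ x → 2 * triangle x ≡ x * suc x
2*triangle zero = refl
2*triangle (suc x) = begin
  2 * triangle (suc x)          ≡⟨ cong (2 *_) (triangle-suc x) ⟩
  2 * (suc x + triangle x)      ≡⟨ *-distribˡ-+ 2 (suc x) (triangle x) ⟩
  2 * suc x + 2 * triangle x    ≡⟨ cong (λ z → 2 * suc x + z) (2*triangle x) ⟩
  2 * suc x + x * suc x         ≡⟨ sym (*-distribʳ-+ (suc x) 2 x) ⟩
  (2 + x) * suc x               ≡⟨ *-comm (2 + x) (suc x) ⟩
  suc x * suc (suc x)           ∎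

module RightHandSide (a′ k′ : ℕ) where

  a k : ℕ
  a = suc a′
  k = suc k′

  denominator : ℕ → ℕ → Series
  denominator i j = poch a i ⊛ poch k j

  Q : ℕ → ℕ → Series
  Q i j = inv (denominator i j)

  denominator-0 : ∀ i j → denominator i j 0 ≡ + 1
  denominator-0 i j rewrite poch-0 a′ i | poch-0 k′ j = refl

  Q-sucˡ : ∀ i j → Q (suc i) j ≈ Q i j +S shift (a * suc i) (Q (suc i) j)
  Q-sucˡ i j = inv-⊛[1−q^c] (a * suc i) (denominator i j) (denominator (suc i) j)
                             (denominator-0 i j) (denominator-0 (suc i) j) move-factor
    where
    X = oneS −S mono (a * suc i)
    move-factor : (poch a i ⊛ X) ⊛ poch k j ≈ (poch a i ⊛ poch k j) ⊛ X
    move-factor m = begin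
      ((poch a i ⊛ X) ⊛ poch k j) m  ≡⟨ ⊛-assoc (poch a i) X (poch k j) m ⟩
      (poch a i ⊛ (X ⊛ poch k j)) m  ≡⟨ ⊛-cong {poch a i} (λ _ → refl) (⊛-comm X (poch k j)) m ⟩
      (poch a i ⊛ (poch k j ⊛ X)) m  ≡⟨ sym (⊛-assoc (poch a i) (poch k j) X m) ⟩
      ((poch a i ⊛ poch k j) ⊛ X) m  ∎

  Q-sucʳ : ∀ i j → Q i (suc j) ≈ Q i j +S shift (k * suc j) (Q i (suc j))
  Q-sucʳ i j = inv-⊛[1−q^c] (k * suc j) (denominator i j) (denominator i (suc j))
                             (denominator-0 i j) (denominator-0 i (suc j))
                             (λ m → sym (⊛-assoc (poch a i) (poch k j) (oneS −S mono (k * suc j)) m))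

  shift-Q-sucˡ : ∀ i j c → shift c (Q (suc i) j) ≈ shift c (Q i j) +S shift (a * suc i + c) (Q (suc i) j)
  shift-Q-sucˡ i j c n =
    trans (shift-cong c (Q-sucˡ i j) n)
          (trans (shift-+S c (Q i j) (shift (a * suc i) (Q (suc i) j)) n)
                 (cong (shift c (Q i j) n +ℤ_) (shift-shift c (a * suc i) (Q (suc i) j) n)))

  shift-Q-sucʳ : ∀ i j c → shift c (Q i (suc j)) ≈ shift c (Q i j) +S shift (k * suc j + c) (Q i (suc j))
  shift-Q-sucʳ i j c n =
    trans (shift-cong c (Q-sucʳ i j) n)
          (trans (shift-+S c (Q i j) (shift (k * suc j) (Q i (suc j))) n)
                 (cong (shift c (Q i j) n +ℤ_) (shift-shift c (k * suc j) (Q i (suc j)) n)))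

  exponent : ℕ → ℕ → ℕ
  exponent i j = i * i * triangle a + a * k * i * j + triangle (k * j)

  rhs : ℕ → ℕ → Series
  rhs s l = rhsCoeff k a s l

  j≤as+kj : ∀ s j → j ≤ a * s + k * j
  j≤as+kj s j = ≤-trans (m≤n*m j k) (m≤n+m (k * j) (a * s))

  rhs-on : ∀ s j {l} → a * s + k * j ≡ l → rhs s l ≈ shift (exponent s j) (Q s j)
  rhs-on s j {l} as+kj≡l n = begin
    rhs s l n
      ≡⟨ sumTo-singleton l j (subst (j ≤_) as+kj≡l (j≤as+kj s j)) other-j ⟩
    (if a * s + k * j ≡ᵇ l then term k a s j n else + 0)
      ≡⟨ if-true (≡⇒≡ᵇ _ l as+kj≡l) ⟩
    term k a s j n
      ≡⟨ mono-⊛ (exponent s j) (Q s j) n ⟩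
    shift (exponent s j) (Q s j) n ∎
    where
    other-j : ∀ t → t ≤ l → t ≢ j → (if a * s + k * t ≡ᵇ l then term k a s t n else + 0) ≡ + 0
    other-j t _ t≢j = if-false λ eq →
      t≢j (*-cancelˡ-≡ t j k (+-cancelˡ-≡ (a * s) (k * t) (k * j) (trans (≡ᵇ⇒≡ _ l eq) (sym as+kj≡l))))

  rhs-off : ∀ s {l} → (∀ j → a * s + k * j ≢ l) → rhs s l ≈ λ _ → + 0
  rhs-off s {l} ¬form n = sumTo-zero l (λ t _ → if-false (¬form t ∘ ≡ᵇ⇒≡ _ l))

  form? : ∀ s l → Dec (∃ λ j → a * s + k * j ≡ l)
  form? s l = map′ (λ (j , _ , eq) → j , eq) (λ (j , eq) → j , s≤s (subst (j ≤_) eq (j≤as+kj s j)) , eq)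
                   (anyUpTo? (λ j → a * s + k * j ≟ l) (suc l))

  -- The size lost by deleting the parts 1, …, k (resp. 1, …, a) and lowering the other parts by k (resp. a + 1).
  weightK weightA : ℕ → ℕ
  weightK l = k * (l ∸ k) + triangle k
  weightA l = suc a * (l ∸ a) + triangle a

  liftedTerm runKTerm runATerm : ℕ → ℕ → Series
  liftedTerm s l = shift l (rhs s l)
  runKTerm s l n = if k ≤ᵇ l then shift (weightK l) (rhs s (l ∸ k)) n else + 0
  runATerm s l n = if 1 ≤ᵇ s then (if a ≤ᵇ l then shift (weightA l) (rhs (s ∸ 1) (l ∸ a)) n else + 0) else + 0

  exponent-sucʳ : ∀ s j → exponent s j + (k * (a * s + k * j) + triangle k) ≡ exponent s (suc j)
  exponent-sucʳ s j = begin
    s * s * A + a * k * s * j + triangle (k * j) + (k * (a * s + k * j) + triangle k)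
      ≡⟨ rearrange s j a k A (triangle k) (triangle (k * j)) ⟩
    s * s * A + a * k * s * suc j + (triangle k + triangle (k * j) + k * (k * j))
      ≡⟨ cong (λ z → s * s * A + a * k * s * suc j + z) (sym (trans (cong triangle (*-suc k j)) (triangle-+ k (k * j)))) ⟩
    s * s * A + a * k * s * suc j + triangle (k * suc j) ∎
    where
    A = triangle a
    rearrange : ∀ s j a k A B C → s * s * A + a * k * s * j + C + (k * (a * s + k * j) + B)
                                ≡ s * s * A + a * k * s * suc j + (B + C + k * (k * j))
    rearrange = ℕ-solve-∀

  exponent-sucˡ : ∀ s j → exponent s j + (suc a * (a * s + k * j) + triangle a) ≡ exponent (suc s) j + k * j
  exponent-sucˡ s j = begin
    s * s * A + a * k * s * j + C + (suc a * (a * s + k * j) + A) ≡⟨ expand-lhs s a k j A C ⟩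
    Z + s * (a * suc a)                                           ≡⟨ cong (λ z → Z + s * z) (sym (2*triangle a)) ⟩
    Z + s * (2 * A)                                               ≡⟨ sym (expand-rhs s a k j A C) ⟩
    suc s * suc s * A + a * k * suc s * j + C + k * j             ∎
    where
    A = triangle a
    C = triangle (k * j)
    Z = s * s * A + a * k * s * j + C + a * k * j + k * j + A
    expand-lhs : ∀ s a k j A C → s * s * A + a * k * s * j + C + (suc a * (a * s + k * j) + A)
                               ≡ s * s * A + a * k * s * j + C + a * k * j + k * j + A + s * (a * suc a)
    expand-lhs = ℕ-solve-∀
    expand-rhs : ∀ s a k j A C → suc s * suc s * A + a * k * suc s * j + C + k * j
                               ≡ s * s * A + a * k * s * j + C + a * k * j + k * j + A + s * (2 * A)
    expand-rhs = ℕ-solve-∀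

  shift-rhs-on : ∀ s j {l} c → a * s + k * j ≡ l → shift c (rhs s l) ≈ shift (exponent s j + c) (Q s j)
  shift-rhs-on s j c as+kj≡l n = trans (shift-cong c (rhs-on s j as+kj≡l) n) (shift-shift c (exponent s j) (Q s j) n)

  runKTerm-on : ∀ s j {l} → a * s + k * suc j ≡ l → runKTerm s l ≈ shift (exponent s (suc j)) (Q s j)
  runKTerm-on s j {l} as+k[1+j]≡l n = begin
    runKTerm s l n
      ≡⟨ if-true (≤⇒≤ᵇ (subst (k ≤_) (sym l≡k+[as+kj]) (m≤m+n k _))) ⟩
    shift (weightK l) (rhs s (l ∸ k)) n
      ≡⟨ shift-rhs-on s j (weightK l) (sym l∸k≡as+kj) n ⟩
    shift (exponent s j + weightK l) (Q s j) n
      ≡⟨ shift-≡ (Q s j) n (trans (cong (λ z → exponent s j + (k * z + triangle k)) l∸k≡as+kj) (exponent-sucʳ s j)) ⟩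
    shift (exponent s (suc j)) (Q s j) n ∎
    where
    l≡k+[as+kj] : l ≡ k + (a * s + k * j)
    l≡k+[as+kj] = trans (sym as+k[1+j]≡l) (trans (cong (λ z → a * s + z) (*-suc k j)) (x+[y+z]≡y+[x+z] (a * s) k (k * j)))
    l∸k≡as+kj : l ∸ k ≡ a * s + k * j
    l∸k≡as+kj = trans (cong (_∸ k) l≡k+[as+kj]) (m+n∸m≡n k _)

  runKTerm-off : ∀ s {l} → (∀ j → a * s + k * suc j ≢ l) → runKTerm s l ≈ λ _ → + 0
  runKTerm-off s {l} ¬form n with k ≤? l
  ... | no k≰l = if-false (k≰l ∘ ≤ᵇ⇒≤ k l)
  ... | yes k≤l = trans (if-true (≤⇒≤ᵇ k≤l)) (trans (shift-cong (weightK l) (rhs-off s ¬form′) n) (shift-zero (weightK l) n))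
    where
    ¬form′ : ∀ j → a * s + k * j ≢ l ∸ k
    ¬form′ j eq = ¬form j (begin
      a * s + k * suc j    ≡⟨ cong (λ z → a * s + z) (*-suc k j) ⟩
      a * s + (k + k * j)  ≡⟨ x+[y+z]≡y+[x+z] (a * s) k (k * j) ⟩
      k + (a * s + k * j)  ≡⟨ cong (λ z → k + z) eq ⟩
      k + (l ∸ k)          ≡⟨ m+[n∸m]≡n k≤l ⟩
      l                    ∎)

  runATerm-on : ∀ s j {l} → a * suc s + k * j ≡ l → runATerm (suc s) l ≈ shift (exponent (suc s) j + k * j) (Q s j)
  runATerm-on s j {l} a[1+s]+kj≡l n = begin
    runATerm (suc s) l n
      ≡⟨ if-true (≤⇒≤ᵇ (subst (a ≤_) (sym l≡a+[as+kj]) (m≤m+n a _))) ⟩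
    shift (weightA l) (rhs s (l ∸ a)) n
      ≡⟨ shift-rhs-on s j (weightA l) (sym l∸a≡as+kj) n ⟩
    shift (exponent s j + weightA l) (Q s j) n
      ≡⟨ shift-≡ (Q s j) n (trans (cong (λ z → exponent s j + (suc a * z + triangle a)) l∸a≡as+kj) (exponent-sucˡ s j)) ⟩
    shift (exponent (suc s) j + k * j) (Q s j) n ∎
    where
    l≡a+[as+kj] : l ≡ a + (a * s + k * j)
    l≡a+[as+kj] = trans (sym a[1+s]+kj≡l) (trans (cong (_+ k * j) (*-suc a s)) (+-assoc a (a * s) (k * j)))
    l∸a≡as+kj : l ∸ a ≡ a * s + k * j
    l∸a≡as+kj = trans (cong (_∸ a) l≡a+[as+kj]) (m+n∸m≡n a _)

  runATerm-off : ∀ s {l} → (∀ j → a * s + k * j ≢ l) → runATerm s l ≈ λ _ → + 0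
  runATerm-off zero ¬form n = refl
  runATerm-off (suc s) {l} ¬form n with a ≤? l
  ... | no a≰l = if-false (a≰l ∘ ≤ᵇ⇒≤ a l)
  ... | yes a≤l = trans (if-true (≤⇒≤ᵇ a≤l)) (trans (shift-cong (weightA l) (rhs-off s ¬form′) n) (shift-zero (weightA l) n))
    where
    ¬form′ : ∀ j → a * s + k * j ≢ l ∸ a
    ¬form′ j eq = ¬form j (begin
      a * suc s + k * j    ≡⟨ cong (_+ k * j) (*-suc a s) ⟩
      a + a * s + k * j    ≡⟨ +-assoc a (a * s) (k * j) ⟩
      a + (a * s + k * j)  ≡⟨ cong (λ z → a + z) eq ⟩
      a + (l ∸ a)          ≡⟨ m+[n∸m]≡n a≤l ⟩
      l                    ∎)

  liftedTerm-on : ∀ s j {l c} → a * s + k * j ≡ l → c ≡ l → liftedTerm s l ≈ shift (c + exponent s j) (Q s j)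
  liftedTerm-on s j {l} as+kj≡l refl n =
    trans (shift-rhs-on s j l as+kj≡l n) (shift-≡ (Q s j) n (+-comm (exponent s j) l))

  liftedTerm-off : ∀ s {l} → (∀ j → a * s + k * j ≢ l) → liftedTerm s l ≈ λ _ → + 0
  liftedTerm-off s {l} ¬form n = trans (shift-cong l (rhs-off s ¬form) n) (shift-zero l n)

  rhs-rec : ∀ s l′ → let l = suc l′ in rhs s l ≈ liftedTerm s l +S (runKTerm s l +S runATerm s l)
  rhs-rec s l′ n with form? s (suc l′)
  rhs-rec s l′ n | no ¬form =
    trans (rhs-off s ¬form′ n)
          (sym (cong₂ _+ℤ_ (liftedTerm-off s ¬form′ n)
                           (cong₂ _+ℤ_ (runKTerm-off s (λ j eq → ¬form (suc j , eq)) n) (runATerm-off s ¬form′ n))))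
    where
    ¬form′ : ∀ j → a * s + k * j ≢ suc l′
    ¬form′ j eq = ¬form (j , eq)
  rhs-rec zero l′ n | yes (zero , 0≡1+l′) = ⊥-elim (0≢1+n (trans (sym (cong₂ _+_ (*-zeroʳ a) (*-zeroʳ k))) 0≡1+l′))
  rhs-rec zero l′ n | yes (suc j , eq) = begin
    rhs 0 l n
      ≡⟨ rhs-on 0 (suc j) eq n ⟩
    shift e (Q 0 (suc j)) n
      ≡⟨ shift-Q-sucʳ 0 j e n ⟩
    shift e (Q 0 j) n +ℤ shift (k * suc j + e) (Q 0 (suc j)) n
      ≡⟨ ℤ.+-comm (shift e (Q 0 j) n) _ ⟩
    shift (k * suc j + e) (Q 0 (suc j)) n +ℤ shift e (Q 0 j) n
      ≡⟨ sym (cong₂ _+ℤ_ (liftedTerm-on 0 (suc j) eq k[1+j]≡l n) (trans (ℤ.+-identityʳ _) (runKTerm-on 0 j eq n))) ⟩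
    liftedTerm 0 l n +ℤ (runKTerm 0 l n +ℤ runATerm 0 l n) ∎
    where
    l = suc l′
    e = exponent 0 (suc j)
    k[1+j]≡l = trans (cong (_+ k * suc j) (sym (*-zeroʳ a))) eq
  rhs-rec (suc s) l′ n | yes (zero , eq) = begin
    rhs (suc s) l n
      ≡⟨ rhs-on (suc s) 0 eq n ⟩
    shift e (Q (suc s) 0) n
      ≡⟨ shift-Q-sucˡ s 0 e n ⟩
    shift e (Q s 0) n +ℤ shift (a * suc s + e) (Q (suc s) 0) n
      ≡⟨ ℤ.+-comm (shift e (Q s 0) n) _ ⟩
    shift (a * suc s + e) (Q (suc s) 0) n +ℤ shift e (Q s 0) n
      ≡⟨ sym (cong₂ _+ℤ_ (liftedTerm-on (suc s) 0 eq a[1+s]≡l n) runK+runA≡) ⟩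
    liftedTerm (suc s) l n +ℤ (runKTerm (suc s) l n +ℤ runATerm (suc s) l n) ∎
    where
    l = suc l′
    e = exponent (suc s) 0
    a[1+s]≡l = trans (sym (+-identityʳ _)) (trans (cong (λ z → a * suc s + z) (sym (*-zeroʳ k))) eq)
    ¬formK : ∀ j → a * suc s + k * suc j ≢ l
    ¬formK j eq′ = 1+n≢0 (*-cancelˡ-≡ (suc j) 0 k (+-cancelˡ-≡ (a * suc s) (k * suc j) (k * 0) (trans eq′ (sym eq))))
    runK+runA≡ : runKTerm (suc s) l n +ℤ runATerm (suc s) l n ≡ shift e (Q s 0) n
    runK+runA≡ = begin
      runKTerm (suc s) l n +ℤ runATerm (suc s) l n
        ≡⟨ cong₂ _+ℤ_ (runKTerm-off (suc s) ¬formK n) (runATerm-on s 0 eq n) ⟩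
      + 0 +ℤ shift (e + k * 0) (Q s 0) n
        ≡⟨ ℤ.+-identityˡ _ ⟩
      shift (e + k * 0) (Q s 0) n
        ≡⟨ shift-≡ (Q s 0) n (trans (cong (λ z → e + z) (*-zeroʳ k)) (+-identityʳ e)) ⟩
      shift e (Q s 0) n ∎
  rhs-rec (suc s) l′ n | yes (suc j , eq) = begin
    rhs (suc s) l n
      ≡⟨ rhs-on (suc s) (suc j) eq n ⟩
    shift e Q₁₁ n
      ≡⟨ shift-Q-sucʳ (suc s) j e n ⟩
    shift e Q₁₀ n +ℤ shift (k * suc j + e) Q₁₁ n
      ≡⟨ cong (shift e Q₁₀ n +ℤ_) (shift-Q-sucˡ s (suc j) (k * suc j + e) n) ⟩
    X +ℤ (Y +ℤ shift (a * suc s + (k * suc j + e)) Q₁₁ n)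
      ≡⟨ x+[y+z]≡z+[x+y] X Y _ ⟩
    shift (a * suc s + (k * suc j + e)) Q₁₁ n +ℤ (X +ℤ Y)
      ≡⟨ cong₂ _+ℤ_ lifted≡ (cong₂ _+ℤ_ (sym (runKTerm-on (suc s) j eq n)) runA≡) ⟩
    liftedTerm (suc s) l n +ℤ (runKTerm (suc s) l n +ℤ runATerm (suc s) l n) ∎
    where
    l = suc l′
    e = exponent (suc s) (suc j)
    Q₁₁ = Q (suc s) (suc j)
    Q₁₀ = Q (suc s) j
    Q₀₁ = Q s (suc j)
    X = shift e Q₁₀ n
    Y = shift (k * suc j + e) Q₀₁ n
    lifted≡ : shift (a * suc s + (k * suc j + e)) Q₁₁ n ≡ liftedTerm (suc s) l n
    lifted≡ = trans (shift-≡ Q₁₁ n (sym (+-assoc (a * suc s) (k * suc j) e))) (sym (liftedTerm-on (suc s) (suc j) eq eq n))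
    runA≡ : Y ≡ runATerm (suc s) l n
    runA≡ = trans (shift-≡ Q₀₁ n (+-comm (k * suc j) e)) (sym (runATerm-on s (suc j) eq n))
    x+[y+z]≡z+[x+y] : ∀ (x y z : ℤ) → x +ℤ (y +ℤ z) ≡ z +ℤ (x +ℤ y)
    x+[y+z]≡z+[x+y] = solve-∀

  rhs-0-0 : rhs 0 0 ≈ oneS
  rhs-0-0 n = begin
    rhs 0 0 n
      ≡⟨ rhs-on 0 0 (cong₂ _+_ (*-zeroʳ a) (*-zeroʳ k)) n ⟩
    shift (exponent 0 0) (Q 0 0) n
      ≡⟨ shift-≡ (Q 0 0) n exponent-0-0 ⟩
    Q 0 0 n
      ≡⟨ inv-unique (denominator 0 0) oneS (denominator-0 0 0) 1⊛1⊛1≈1 n ⟩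
    oneS n ∎
    where
    exponent-0-0 : exponent 0 0 ≡ 0
    exponent-0-0 = cong₂ (λ x y → x + triangle y) (*-zeroʳ (a * k * 0)) (*-zeroʳ k)
    1⊛1⊛1≈1 : (oneS ⊛ oneS) ⊛ oneS ≈ oneS
    1⊛1⊛1≈1 m = trans (⊛-comm (oneS ⊛ oneS) oneS m) (trans (oneS-⊛ (oneS ⊛ oneS) m) (oneS-⊛ oneS m))

  rhs-suc-0 : ∀ s → rhs (suc s) 0 ≈ λ _ → + 0
  rhs-suc-0 s = rhs-off (suc s) {0} (λ j ())

-- Runs of consecutive elements

module _ {A : Set} (R : A → A → Bool) where

  runsFrom : A → ℕ → List A → List ℕ
  runsFrom prev len [] = len ∷ []
  runsFrom prev len (p ∷ ps) = if R prev p then runsFrom p (suc len) ps else len ∷ runsFrom p 1 ps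

  runs : List A → List ℕ
  runs [] = []
  runs (p ∷ ps) = runsFrom p 1 ps

mapHead : ∀ {A : Set} → (A → A) → List A → List A
mapHead f [] = []
mapHead f (x ∷ xs) = f x ∷ xs

runsFrom-+ : ∀ {A : Set} (R : A → A → Bool) p c len ρ →
             runsFrom R p (c + len) ρ ≡ mapHead (λ r → c + r) (runsFrom R p len ρ)
runsFrom-+ R p c len [] = refl
runsFrom-+ R p c len (q ∷ ρ) with R p q
... | true = trans (cong (λ z → runsFrom R q z ρ) (sym (+-suc c len))) (runsFrom-+ R q c (suc len) ρ)
... | false = refl

runs-reverseAcc : ∀ {A : Set} (R : A → A → Bool) y ys xs m rest → runs (flip R) (y ∷ ys) ≡ m ∷ rest →
                  runs (flip R) (reverseAcc (y ∷ ys) xs) ≡ reverseAcc rest (runsFrom R y m xs)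
runs-reverseAcc R y ys [] m rest eq = eq
runs-reverseAcc R y ys (x ∷ xs) m rest eq with R y x in Ryx
... | true = runs-reverseAcc R x (y ∷ ys) xs (suc m) rest (begin
  runs (flip R) (x ∷ y ∷ ys)
    ≡⟨ cong (λ b → if b then runsFrom (flip R) y 2 ys else 1 ∷ runsFrom (flip R) y 1 ys) Ryx ⟩
  runsFrom (flip R) y (1 + 1) ys
    ≡⟨ runsFrom-+ (flip R) y 1 1 ys ⟩
  mapHead suc (runs (flip R) (y ∷ ys))
    ≡⟨ cong (mapHead suc) eq ⟩
  suc m ∷ rest ∎)
... | false = runs-reverseAcc R x (y ∷ ys) xs 1 (m ∷ rest)
  (trans (cong (λ b → if b then runsFrom (flip R) y 2 ys else 1 ∷ runsFrom (flip R) y 1 ys) Ryx) (cong (1 ∷_) eq))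

runs-reverse : ∀ {A : Set} (R : A → A → Bool) xs → runs (flip R) (reverse xs) ≡ reverse (runs R xs)
runs-reverse R [] = refl
runs-reverse R (x ∷ xs) = runs-reverseAcc R x [] xs 1 [] refl

-- Strict partitions as increasing lists

Linked-reverseAcc : ∀ {A : Set} {R : A → A → Set} {y} ys xs →
                    Linked (flip R) (y ∷ ys) → Linked R (y ∷ xs) → Linked (flip R) (reverseAcc (y ∷ ys) xs)
Linked-reverseAcc ys [] acc _ = acc
Linked-reverseAcc {y = y} ys (x ∷ xs) acc (Ryx ∷ rest) = Linked-reverseAcc (y ∷ ys) xs (Ryx ∷ acc) rest

Linked-reverse : ∀ {A : Set} {R : A → A → Set} {xs} → Linked R xs → Linked (flip R) (reverse xs)
Linked-reverse {xs = []} _ = []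
Linked-reverse {xs = x ∷ xs} lk = Linked-reverseAcc [] xs [-] lk

StrictPartition⇒Linked : ∀ {ps} → StrictPartition ps → Linked _>_ (ps ++ 0 ∷ [])
StrictPartition⇒Linked {[]} _ = [-]
StrictPartition⇒Linked {x ∷ []} (_ , 0<x ∷ []) = 0<x ∷ [-]
StrictPartition⇒Linked {x ∷ y ∷ ps} (y<x ∷ lk , _ ∷ pos) = y<x ∷ StrictPartition⇒Linked (lk , pos)

Linked⇒StrictPartition : ∀ ps → Linked _>_ (ps ++ 0 ∷ []) → StrictPartition ps
Linked⇒StrictPartition [] _ = [] , []
Linked⇒StrictPartition (x ∷ []) (0<x ∷ [-]) = [-] , 0<x ∷ []
Linked⇒StrictPartition (x ∷ y ∷ ps) (y<x ∷ lk) with Linked⇒StrictPartition (y ∷ ps) lk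
... | lk′ , 0<y ∷ pos = y<x ∷ lk′ , <-trans 0<y y<x ∷ 0<y ∷ pos

StrictPartition-irrelevant : ∀ {ps} (p q : StrictPartition ps) → p ≡ q
StrictPartition-irrelevant (lk , pos) (lk′ , pos′) =
  cong₂ _,_ (Linked.irrelevant <-irrelevant lk lk′) (All.irrelevant <-irrelevant pos pos′)

Ascending : ℕ → List ℕ → Set
Ascending m ρ = Linked _<_ (m ∷ ρ)

StrictPartition⇒Ascending : ∀ {ps} → StrictPartition ps → Ascending 0 (reverse ps)
StrictPartition⇒Ascending {ps} sp = subst (Linked _<_) (reverse-++ ps (0 ∷ [])) (Linked-reverse (StrictPartition⇒Linked sp))

Ascending⇒StrictPartition : ∀ {ρ} → Ascending 0 ρ → StrictPartition (reverse ρ)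
Ascending⇒StrictPartition {ρ} asc = Linked⇒StrictPartition (reverse ρ) (subst (Linked _>_) (unfold-reverse 0 ρ) (Linked-reverse asc))

ascStep : ℕ → ℕ → Bool
ascStep prev p = suc prev ≡ᵇ p

ascRuns : List ℕ → List ℕ
ascRuns = runs ascStep

runsGo≡runsFrom : ∀ prev len ps → runsGo prev len ps ≡ runsFrom (flip ascStep) prev len ps
runsGo≡runsFrom prev len [] = refl
runsGo≡runsFrom prev len (p ∷ ps) with suc p ≡ᵇ prev
... | true = runsGo≡runsFrom p (suc len) ps
... | false = cong (len ∷_) (runsGo≡runsFrom p 1 ps)

seqLengths-reverse : ∀ ρ → seqLengths (reverse ρ) ≡ reverse (ascRuns ρ)
seqLengths-reverse ρ = trans (seqLengths≡runs (reverse ρ)) (runs-reverse ascStep ρ)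
  where
  seqLengths≡runs : ∀ ps → seqLengths ps ≡ runs (flip ascStep) ps
  seqLengths≡runs [] = refl
  seqLengths≡runs (p ∷ ps) = runsGo≡runsFrom p 1 ps

raise : ℕ → List ℕ → List ℕ
raise c = map (λ x → c + x)

lower : ℕ → List ℕ → List ℕ
lower c = map (_∸ c)

consecutive : ℕ → ℕ → List ℕ
consecutive b zero = []
consecutive b (suc c) = suc b ∷ consecutive (suc b) c

initialRun : ℕ → List ℕ → ℕ
initialRun b [] = 0
initialRun b (p ∷ ps) = if suc b ≡ᵇ p then suc (initialRun p ps) else 0

Ascending-raise : ∀ c m ν → Ascending m ν → Ascending (c + m) (raise c ν)
Ascending-raise c m ν asc = Linked.map⁺ (Linked.map (+-monoʳ-< c) asc)

Ascending-raise⁻ : ∀ c m ν → Ascending (c + m) (raise c ν) → Ascending m ν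
Ascending-raise⁻ c m ν asc = Linked.map (+-cancelˡ-< c _ _) (Linked.map⁻ {xs = m ∷ ν} asc)

Ascending-raise₀ : ∀ c ν → Ascending 0 ν → Ascending c (raise c ν)
Ascending-raise₀ c ν asc = subst (λ z → Ascending z (raise c ν)) (+-identityʳ c) (Ascending-raise c 0 ν asc)

Ascending-raise₀⁻ : ∀ c ν → Ascending c (raise c ν) → Ascending 0 ν
Ascending-raise₀⁻ c ν asc = Ascending-raise⁻ c 0 ν (subst (λ z → Ascending z (raise c ν)) (sym (+-identityʳ c)) asc)

Ascending-weaken : ∀ {m m′ X} → m ≤ m′ → Ascending m′ X → Ascending m X
Ascending-weaken {X = []} _ _ = [-]
Ascending-weaken {X = x ∷ X} m≤m′ (m′<x ∷ asc) = ≤-<-trans m≤m′ m′<x ∷ asc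

Ascending⇒All : ∀ {m X} → Ascending m X → All (m <_) X
Ascending⇒All {X = []} _ = []
Ascending⇒All {X = x ∷ X} (m<x ∷ asc) = Linked⇒All <-trans m<x asc

Ascending-consecutive : ∀ b c rest → Ascending (b + c) rest → Ascending b (consecutive b c ++ rest)
Ascending-consecutive b zero rest asc = subst (λ z → Ascending z rest) (+-identityʳ b) asc
Ascending-consecutive b (suc c) rest asc =
  ≤-refl ∷ Ascending-consecutive (suc b) c rest (subst (λ z → Ascending z rest) (+-suc b c) asc)

Ascending-consecutive⁻ : ∀ b c rest → Ascending b (consecutive b c ++ rest) → Ascending (b + c) rest
Ascending-consecutive⁻ b zero rest asc = subst (λ z → Ascending z rest) (sym (+-identityʳ b)) asc
Ascending-consecutive⁻ b (suc c) rest (_ ∷ asc) =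
  subst (λ z → Ascending z rest) (sym (+-suc b c)) (Ascending-consecutive⁻ (suc b) c rest asc)

Ascending-suc : ∀ {m X} → Ascending m X → initialRun m X ≡ 0 → Ascending (suc m) X
Ascending-suc {X = []} _ _ = [-]
Ascending-suc {m} {X = x ∷ X} (m<x ∷ asc) run≡0 with suc m ≟ x
... | yes refl = contradiction (trans (sym (if-true (≡⇒≡ᵇ (suc m) (suc m) refl))) run≡0) λ ()
... | no 1+m≢x = ≤∧≢⇒< m<x 1+m≢x ∷ asc

initialRun-consecutive : ∀ b c rest → initialRun b (consecutive b c ++ rest) ≡ c + initialRun (b + c) rest
initialRun-consecutive b zero rest = cong (λ z → initialRun z rest) (sym (+-identityʳ b))
initialRun-consecutive b (suc c) rest = begin
  (if suc b ≡ᵇ suc b then suc (initialRun (suc b) (consecutive (suc b) c ++ rest)) else 0)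
    ≡⟨ if-true (≡⇒≡ᵇ (suc b) (suc b) refl) ⟩
  suc (initialRun (suc b) (consecutive (suc b) c ++ rest))
    ≡⟨ cong suc (initialRun-consecutive (suc b) c rest) ⟩
  suc (c + initialRun (suc b + c) rest)
    ≡⟨ cong (λ z → suc (c + initialRun z rest)) (sym (+-suc b c)) ⟩
  suc c + initialRun (b + suc c) rest ∎

consecutive-prefix : ∀ b c ρ → c ≤ initialRun b ρ → ρ ≡ consecutive b c ++ drop c ρ
consecutive-prefix b zero ρ _ = refl
consecutive-prefix b (suc c) (p ∷ ps) c<run with suc b ≟ p
... | yes refl =
  cong (suc b ∷_) (consecutive-prefix (suc b) c ps (≤-pred (subst (suc c ≤_) (if-true (≡⇒≡ᵇ (suc b) (suc b) refl)) c<run)))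
... | no 1+b≢p = contradiction (subst (suc c ≤_) (if-false (1+b≢p ∘ ≡ᵇ⇒≡ (suc b) p)) c<run) λ ()

drop-consecutive : ∀ b c X → drop c (consecutive b c ++ X) ≡ X
drop-consecutive b zero X = refl
drop-consecutive b (suc c) X = drop-consecutive (suc b) c X

raise-lower : ∀ c X → All (c ≤_) X → raise c (lower c X) ≡ X
raise-lower c [] _ = refl
raise-lower c (x ∷ X) (c≤x ∷ c≤X) = cong₂ _∷_ (m+[n∸m]≡n c≤x) (raise-lower c X c≤X)

lower-raise : ∀ c ν → lower c (raise c ν) ≡ ν
lower-raise c [] = refl
lower-raise c (x ∷ ν) = cong₂ _∷_ (m+n∸m≡n c x) (lower-raise c ν)

c+m≡ᵇc+n : ∀ c m n → (c + m ≡ᵇ c + n) ≡ (m ≡ᵇ n)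
c+m≡ᵇc+n zero m n = refl
c+m≡ᵇc+n (suc c) m n = c+m≡ᵇc+n c m n

runsFrom-raise : ∀ c p len ν → runsFrom ascStep (c + p) len (raise c ν) ≡ runsFrom ascStep p len ν
runsFrom-raise c p len [] = refl
runsFrom-raise c p len (q ∷ ν) rewrite sym (+-suc c p) | c+m≡ᵇc+n c (suc p) q with suc p ≡ᵇ q
... | true = runsFrom-raise c q (suc len) ν
... | false = cong (len ∷_) (runsFrom-raise c q 1 ν)

ascRuns-raise : ∀ c ν → ascRuns (raise c ν) ≡ ascRuns ν
ascRuns-raise c [] = refl
ascRuns-raise c (p ∷ ν) = runsFrom-raise c p 1 ν

runsFrom-consecutive : ∀ b c len rest →
  runsFrom ascStep b len (consecutive b c ++ rest) ≡ runsFrom ascStep (b + c) (c + len) rest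
runsFrom-consecutive b zero len rest = cong (λ z → runsFrom ascStep z len rest) (sym (+-identityʳ b))
runsFrom-consecutive b (suc c) len rest = begin
  runsFrom ascStep b len (suc b ∷ consecutive (suc b) c ++ rest)
    ≡⟨ if-true (≡⇒≡ᵇ (suc b) (suc b) refl) ⟩
  runsFrom ascStep (suc b) (suc len) (consecutive (suc b) c ++ rest)
    ≡⟨ runsFrom-consecutive (suc b) c (suc len) rest ⟩
  runsFrom ascStep (suc b + c) (c + suc len) rest
    ≡⟨ cong₂ (λ x y → runsFrom ascStep x y rest) (sym (+-suc b c)) (+-suc c len) ⟩
  runsFrom ascStep (b + suc c) (suc c + len) rest ∎

ascRuns-consecutive : ∀ c′ X → let c = suc c′ in ascRuns (consecutive 0 c ++ X) ≡ runsFrom ascStep c c X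
ascRuns-consecutive c′ X =
  trans (runsFrom-consecutive 1 c′ 1 X) (cong (λ z → runsFrom ascStep (suc c′) z X) (+-comm c′ 1))

runsFrom-gap : ∀ m len rest → Ascending (suc m) rest → runsFrom ascStep m len rest ≡ len ∷ ascRuns rest
runsFrom-gap m len [] _ = refl
runsFrom-gap m len (q ∷ rest) (1+m<q ∷ _) = if-false (<⇒≢ 1+m<q ∘ ≡ᵇ⇒≡ (suc m) q)

runsFrom-0 : ∀ c ν → runsFrom ascStep 0 c ν ≡ c ∷ ascRuns ν ⊎ runsFrom ascStep 0 c ν ≡ mapHead (λ r → c + r) (ascRuns ν)
runsFrom-0 c [] = inj₁ refl
runsFrom-0 c (p ∷ ν) with 1 ≟ p
... | yes refl = inj₂ (trans (cong (λ z → runsFrom ascStep 1 z ν) (+-comm 1 c)) (runsFrom-+ ascStep 1 c 1 ν))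
... | no 1≢p = inj₁ (if-false (1≢p ∘ ≡ᵇ⇒≡ 1 p))

length-consecutive : ∀ b c → length (consecutive b c) ≡ c
length-consecutive b zero = refl
length-consecutive b (suc c) = cong suc (length-consecutive (suc b) c)

sum-consecutive : ∀ b c → sum (consecutive b c) ≡ c * b + triangle c
sum-consecutive b zero = refl
sum-consecutive b (suc c) = begin
  suc b + sum (consecutive (suc b) c)   ≡⟨ cong (λ z → suc b + z) (sum-consecutive (suc b) c) ⟩
  suc b + (c * suc b + triangle c)      ≡⟨ rearrange b c (triangle c) ⟩
  suc c * b + (suc c + triangle c)      ≡⟨ cong (λ z → suc c * b + z) (sym (triangle-suc c)) ⟩
  suc c * b + triangle (suc c)          ∎
  where
  rearrange : ∀ b c T → suc b + (c * suc b + T) ≡ suc c * b + (suc c + T)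
  rearrange = ℕ-solve-∀

sum-raise : ∀ c ν → sum (raise c ν) ≡ c * length ν + sum ν
sum-raise c [] = sym (trans (+-identityʳ (c * 0)) (*-zeroʳ c))
sum-raise c (x ∷ ν) = begin
  c + x + sum (raise c ν)         ≡⟨ cong (λ z → c + x + z) (sum-raise c ν) ⟩
  c + x + (c * length ν + sum ν)  ≡⟨ rearrange c x (length ν) (sum ν) ⟩
  c * suc (length ν) + (x + sum ν) ∎
  where
  rearrange : ∀ c x L S → c + x + (c * L + S) ≡ c * suc L + (x + S)
  rearrange = ℕ-solve-∀

allᵇ-++ : ∀ f xs ys → allᵇ f (xs ++ ys) ≡ allᵇ f xs ∧ allᵇ f ys
allᵇ-++ f [] ys = refl
allᵇ-++ f (x ∷ xs) ys = trans (cong (f x ∧_) (allᵇ-++ f xs ys)) (sym (∧-assoc (f x) _ _))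

allᵇ-reverse : ∀ f xs → allᵇ f (reverse xs) ≡ allᵇ f xs
allᵇ-reverse f [] = refl
allᵇ-reverse f (x ∷ xs) = begin
  allᵇ f (reverse (x ∷ xs))
    ≡⟨ cong (allᵇ f) (unfold-reverse x xs) ⟩
  allᵇ f (reverse xs ++ x ∷ [])
    ≡⟨ allᵇ-++ f (reverse xs) (x ∷ []) ⟩
  allᵇ f (reverse xs) ∧ (f x ∧ true)
    ≡⟨ cong₂ _∧_ (allᵇ-reverse f xs) (∧-identityʳ (f x)) ⟩
  allᵇ f xs ∧ f x
    ≡⟨ ∧-comm (allᵇ f xs) (f x) ⟩
  f x ∧ allᵇ f xs ∎

count : ∀ {A : Set} → (A → Bool) → List A → ℕ
count p = length ∘ filterᵇ p

count-reverse : ∀ {A : Set} (f : A → Bool) xs → count f (reverse xs) ≡ count f xs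
count-reverse f xs = ↭-length (filter-↭ (T? ∘ f) (↭-reverse xs))

count-∷ : ∀ {A : Set} (f : A → Bool) x xs →
  count f (x ∷ xs) ≡ (if f x then suc (count f xs) else count f xs)
count-∷ f x xs with f x
... | true = refl
... | false = refl

count-∷-accept : ∀ {A : Set} (f : A → Bool) x xs → f x ≡ true → count f (x ∷ xs) ≡ suc (count f xs)
count-∷-accept f x xs fx≡true = trans (count-∷ f x xs) (cong (λ b → if b then suc (count f xs) else count f xs) fx≡true)

count-∷-reject : ∀ {A : Set} (f : A → Bool) x xs → f x ≡ false → count f (x ∷ xs) ≡ count f xs
count-∷-reject f x xs fx≡false = trans (count-∷ f x xs) (cong (λ b → if b then suc (count f xs) else count f xs) fx≡false)

count-mapHead : ∀ {A : Set} (f : A → Bool) g → (∀ x → f (g x) ≡ f x) → ∀ xs → count f (mapHead g xs) ≡ count f xs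
count-mapHead f g fg≡f [] = refl
count-mapHead f g fg≡f (x ∷ xs) =
  trans (count-∷ f (g x) xs) (trans (cong (λ b → if b then suc (count f xs) else count f xs) (fg≡f x)) (sym (count-∷ f x xs)))

allᵇ-mapHead : ∀ f g → (∀ x → f (g x) ≡ f x) → ∀ xs → allᵇ f (mapHead g xs) ≡ allᵇ f xs
allᵇ-mapHead f g fg≡f [] = refl
allᵇ-mapHead f g fg≡f (x ∷ xs) = cong (_∧ allᵇ f xs) (fg≡f x)

sum-reverse : ∀ xs → sum (reverse xs) ≡ sum xs
sum-reverse xs = sum-↭ (↭-reverse xs)

prefix-split : ∀ c ρ → c ≤ initialRun 0 ρ → Ascending 0 ρ → ρ ≡ consecutive 0 c ++ drop c ρ × Ascending c (drop c ρ)
prefix-split c ρ c≤run asc = ρ≡ , Ascending-consecutive⁻ 0 c (drop c ρ) (subst (Ascending 0) ρ≡ asc)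
  where ρ≡ = consecutive-prefix 0 c ρ c≤run

prefix-split-exact : ∀ c ρ → initialRun 0 ρ ≡ c → Ascending 0 ρ →
                     ρ ≡ consecutive 0 c ++ drop c ρ × Ascending (suc c) (drop c ρ)
prefix-split-exact c ρ run≡c asc = ρ≡ , Ascending-suc ascX rest-run≡0
  where
  split = prefix-split c ρ (≤-reflexive (sym run≡c)) asc
  ρ≡ = proj₁ split
  ascX = proj₂ split
  rest-run≡0 : initialRun c (drop c ρ) ≡ 0
  rest-run≡0 = +-cancelˡ-≡ c _ 0 (begin
    c + initialRun c (drop c ρ)                    ≡⟨ sym (initialRun-consecutive 0 c (drop c ρ)) ⟩
    initialRun 0 (consecutive 0 c ++ drop c ρ)     ≡⟨ cong (initialRun 0) (sym ρ≡) ⟩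
    initialRun 0 ρ                                 ≡⟨ run≡c ⟩
    c                                              ≡⟨ sym (+-identityʳ c) ⟩
    c + 0                                          ∎)

raise-lower-Ascending : ∀ c X → Ascending c X → raise c (lower c X) ≡ X × Ascending 0 (lower c X)
raise-lower-Ascending c X asc =
  X≡ , Ascending-raise₀⁻ c (lower c X) (subst (Ascending c) (sym X≡) asc)
  where X≡ = raise-lower c X (All.map <⇒≤ (Ascending⇒All asc))

initialRun-raise : ∀ c ν → Ascending 0 ν → initialRun c (raise (suc c) ν) ≡ 0
initialRun-raise c [] _ = refl
initialRun-raise c (p ∷ ν) (0<p ∷ _) = if-false λ eq →
  <⇒≢ 0<p (sym (+-cancelˡ-≡ (suc c) p 0 (sym (trans (+-identityʳ (suc c)) (≡ᵇ⇒≡ _ _ eq)))))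

ascRuns-initialRun : ∀ r′ ρ → initialRun 0 ρ ≡ suc r′ → Ascending 0 ρ →
                     ascRuns ρ ≡ suc r′ ∷ ascRuns (drop (suc r′) ρ)
ascRuns-initialRun r′ ρ run≡ asc = begin
  ascRuns ρ                                          ≡⟨ cong ascRuns ρ≡ ⟩
  ascRuns (consecutive 0 (suc r′) ++ X)              ≡⟨ ascRuns-consecutive r′ X ⟩
  runsFrom ascStep (suc r′) (suc r′) X               ≡⟨ runsFrom-gap (suc r′) (suc r′) X ascX ⟩
  suc r′ ∷ ascRuns X                                 ∎
  where
  X = drop (suc r′) ρ
  split = prefix-split-exact (suc r′) ρ run≡ asc
  ρ≡ = proj₁ split
  ascX = proj₂ split

-- Decomposing the partitions in D_{k,a}

module Partitions (a′ k′ : ℕ) (a<k : suc a′ < suc k′) where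

  open RightHandSide a′ k′ using (a; k; weightK; weightA)

  residue0orA residueA : ℕ → Bool
  residue0orA m = (m % k ≡ᵇ 0) ∨ (m % k ≡ᵇ a % k)
  residueA m = m % k ≡ᵇ a % k

  IsAscD : ℕ → ℕ → ℕ → List ℕ → Set
  IsAscD s l n ρ = Ascending 0 ρ × T (allᵇ residue0orA (ascRuns ρ))
                 × (count residueA (ascRuns ρ) ≡ s) × (length ρ ≡ l) × (sum ρ ≡ n)

  AscD : ℕ → ℕ → ℕ → Set
  AscD s l n = Σ (List ℕ) (IsAscD s l n)

  IsAscD-irrelevant : ∀ {s l n ρ} (p q : IsAscD s l n ρ) → p ≡ q
  IsAscD-irrelevant (asc , adm , sl≡ , len≡ , sum≡) (asc′ , adm′ , sl≡′ , len≡′ , sum≡′) =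
    cong₂ _,_ (Linked.irrelevant <-irrelevant asc asc′) (cong₂ _,_ (T-irrelevant adm adm′)
      (cong₂ _,_ (≡-irrelevant sl≡ sl≡′) (cong₂ _,_ (≡-irrelevant len≡ len≡′) (≡-irrelevant sum≡ sum≡′))))

  AscD-≡ : ∀ {s l n ρ ρ′} → ρ ≡ ρ′ → (p : IsAscD s l n ρ) (q : IsAscD s l n ρ′) →
           _≡_ {A = AscD s l n} (ρ , p) (ρ′ , q)
  AscD-≡ refl p q = cong (_ ,_) (IsAscD-irrelevant p q)

  inD-reverse : ∀ ρ → inD k a (reverse ρ) ≡ allᵇ residue0orA (ascRuns ρ)
  inD-reverse ρ = trans (cong (allᵇ residue0orA) (seqLengths-reverse ρ)) (allᵇ-reverse residue0orA (ascRuns ρ))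

  sl-reverse : ∀ ρ → sl k a (reverse ρ) ≡ count residueA (ascRuns ρ)
  sl-reverse ρ = trans (cong (count residueA) (seqLengths-reverse ρ)) (count-reverse residueA (ascRuns ρ))

  DPart↔AscD : ∀ s l n → DPart k a s l n ↔ AscD s l n
  DPart↔AscD s l n = mk↔ₛ′ to from to∘from from∘to
    where
    to : DPart k a s l n → AscD s l n
    to (ps , sp , ind , sl≡ , len≡ , sum≡) =
      reverse ps ,
      StrictPartition⇒Ascending sp ,
      subst T (trans (cong (inD k a) (sym (reverse-involutive ps))) (inD-reverse (reverse ps))) ind ,
      trans (sym (trans (cong (sl k a) (sym (reverse-involutive ps))) (sl-reverse (reverse ps)))) sl≡ ,
      trans (length-reverse ps) len≡ ,
      trans (sum-reverse ps) sum≡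
    from : AscD s l n → DPart k a s l n
    from (ρ , asc , adm , sl≡ , len≡ , sum≡) =
      reverse ρ , Ascending⇒StrictPartition asc , subst T (sym (inD-reverse ρ)) adm , trans (sl-reverse ρ) sl≡ ,
      trans (length-reverse ρ) len≡ , trans (sum-reverse ρ) sum≡
    to∘from : ∀ x → to (from x) ≡ x
    to∘from (ρ , p) = AscD-≡ (reverse-involutive ρ) _ p
    from∘to : ∀ x → from (to x) ≡ x
    from∘to (ps , p) = DPart-≡ (reverse-involutive ps) _ p
      where
      DPart-≡ : ∀ {ps ps′} → ps ≡ ps′ → ∀ p q → _≡_ {A = DPart k a s l n} (ps , p) (ps′ , q)
      DPart-≡ refl (sp , ind , sl≡ , len≡ , sum≡) (sp′ , ind′ , sl≡′ , len≡′ , sum≡′) =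
        cong (_ ,_) (cong₂ _,_ (StrictPartition-irrelevant sp sp′) (cong₂ _,_ (T-irrelevant ind ind′)
          (cong₂ _,_ (≡-irrelevant sl≡ sl≡′) (cong₂ _,_ (≡-irrelevant len≡ len≡′) (≡-irrelevant sum≡ sum≡′)))))

  a%k≡a : a % k ≡ a
  a%k≡a = m<n⇒m%n≡m a<k

  [k+x]%k≡x%k : ∀ x → (k + x) % k ≡ x % k
  [k+x]%k≡x%k x = trans (cong (_% k) (+-comm k x)) ([m+n]%n≡m%n x k)

  residue0orA-k+ : ∀ x → residue0orA (k + x) ≡ residue0orA x
  residue0orA-k+ x = cong (λ r → (r ≡ᵇ 0) ∨ (r ≡ᵇ a % k)) ([k+x]%k≡x%k x)

  residueA-k+ : ∀ x → residueA (k + x) ≡ residueA x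
  residueA-k+ x = cong (_≡ᵇ a % k) ([k+x]%k≡x%k x)

  residue0orA-k : residue0orA k ≡ true
  residue0orA-k = cong (λ r → (r ≡ᵇ 0) ∨ (r ≡ᵇ a % k)) (n%n≡0 k)

  residueA-k : residueA k ≡ false
  residueA-k = cong₂ _≡ᵇ_ (n%n≡0 k) a%k≡a

  residueA-a : residueA a ≡ true
  residueA-a = ≡ᵇ-refl (a % k)

  residue0orA-a : residue0orA a ≡ true
  residue0orA-a = trans (cong (λ r → (r ≡ᵇ 0) ∨ (r ≡ᵇ r)) a%k≡a) (≡ᵇ-refl a)

  withRunK withRunA : List ℕ → List ℕ
  withRunK ν = consecutive 0 k ++ raise k ν
  withRunA ν = consecutive 0 a ++ raise (suc a) ν

  ascRuns-withRunK : ∀ ν →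
    ascRuns (withRunK ν) ≡ k ∷ ascRuns ν ⊎ ascRuns (withRunK ν) ≡ mapHead (λ r → k + r) (ascRuns ν)
  ascRuns-withRunK ν =
    subst (λ rs → rs ≡ k ∷ ascRuns ν ⊎ rs ≡ mapHead (λ r → k + r) (ascRuns ν)) (sym runs≡) (runsFrom-0 k ν)
    where
    runs≡ : ascRuns (withRunK ν) ≡ runsFrom ascStep 0 k ν
    runs≡ = begin
      ascRuns (withRunK ν)                      ≡⟨ ascRuns-consecutive k′ (raise k ν) ⟩
      runsFrom ascStep k k (raise k ν)          ≡⟨ cong (λ z → runsFrom ascStep z k (raise k ν)) (sym (+-identityʳ k)) ⟩
      runsFrom ascStep (k + 0) k (raise k ν)    ≡⟨ runsFrom-raise k 0 k ν ⟩
      runsFrom ascStep 0 k ν                    ∎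

  allᵇ-withRunK : ∀ ν → allᵇ residue0orA (ascRuns (withRunK ν)) ≡ allᵇ residue0orA (ascRuns ν)
  allᵇ-withRunK ν with ascRuns-withRunK ν
  ... | inj₁ eq = trans (cong (allᵇ residue0orA) eq) (cong (_∧ allᵇ residue0orA (ascRuns ν)) residue0orA-k)
  ... | inj₂ eq = trans (cong (allᵇ residue0orA) eq) (allᵇ-mapHead residue0orA (λ r → k + r) residue0orA-k+ (ascRuns ν))

  count-withRunK : ∀ ν → count residueA (ascRuns (withRunK ν)) ≡ count residueA (ascRuns ν)
  count-withRunK ν with ascRuns-withRunK ν
  ... | inj₁ eq = trans (cong (count residueA) eq) (count-∷-reject residueA k (ascRuns ν) residueA-k)
  ... | inj₂ eq = trans (cong (count residueA) eq) (count-mapHead residueA (λ r → k + r) residueA-k+ (ascRuns ν))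

  ascRuns-withRunA : ∀ ν → Ascending 0 ν → ascRuns (withRunA ν) ≡ a ∷ ascRuns ν
  ascRuns-withRunA ν asc = begin
    ascRuns (withRunA ν)                        ≡⟨ ascRuns-consecutive a′ (raise (suc a) ν) ⟩
    runsFrom ascStep a a (raise (suc a) ν)      ≡⟨ runsFrom-gap a a (raise (suc a) ν) (Ascending-raise₀ (suc a) ν asc) ⟩
    a ∷ ascRuns (raise (suc a) ν)               ≡⟨ cong (a ∷_) (ascRuns-raise (suc a) ν) ⟩
    a ∷ ascRuns ν                               ∎

  allᵇ-withRunA : ∀ ν → Ascending 0 ν → allᵇ residue0orA (ascRuns (withRunA ν)) ≡ allᵇ residue0orA (ascRuns ν)
  allᵇ-withRunA ν asc =
    trans (cong (allᵇ residue0orA) (ascRuns-withRunA ν asc)) (cong (_∧ allᵇ residue0orA (ascRuns ν)) residue0orA-a)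

  count-withRunA : ∀ ν → Ascending 0 ν →
    count residueA (ascRuns (withRunA ν)) ≡ suc (count residueA (ascRuns ν))
  count-withRunA ν asc =
    trans (cong (count residueA) (ascRuns-withRunA ν asc)) (count-∷-accept residueA a (ascRuns ν) residueA-a)

  length-withRunK : ∀ ν → length (withRunK ν) ≡ k + length ν
  length-withRunK ν = trans (length-++ (consecutive 0 k)) (cong₂ _+_ (length-consecutive 0 k) (length-map _ ν))

  length-withRunA : ∀ ν → length (withRunA ν) ≡ a + length ν
  length-withRunA ν = trans (length-++ (consecutive 0 a)) (cong₂ _+_ (length-consecutive 0 a) (length-map _ ν))

  sum-block-raise : ∀ c d ν → sum (consecutive 0 c ++ raise d ν) ≡ d * length ν + triangle c + sum ν
  sum-block-raise c d ν = begin
    sum (consecutive 0 c ++ raise d ν)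
      ≡⟨ sum-++ (consecutive 0 c) (raise d ν) ⟩
    sum (consecutive 0 c) + sum (raise d ν)
      ≡⟨ cong₂ _+_ (trans (sum-consecutive 0 c) (cong (_+ triangle c) (*-zeroʳ c))) (sum-raise d ν) ⟩
    triangle c + (d * length ν + sum ν)
      ≡⟨ x+[y+z]≡y+[x+z] (triangle c) (d * length ν) (sum ν) ⟩
    d * length ν + (triangle c + sum ν)
      ≡⟨ sym (+-assoc (d * length ν) (triangle c) (sum ν)) ⟩
    d * length ν + triangle c + sum ν ∎

  sum-withRunK : ∀ ν → sum (withRunK ν) ≡ weightK (k + length ν) + sum ν
  sum-withRunK ν = trans (sum-block-raise k k ν) (cong (λ z → k * z + triangle k + sum ν) (sym (m+n∸m≡n k (length ν))))

  sum-withRunA : ∀ ν → sum (withRunA ν) ≡ weightA (a + length ν) + sum ν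
  sum-withRunA ν = trans (sum-block-raise a (suc a) ν) (cong (λ z → suc a * z + triangle a + sum ν) (sym (m+n∸m≡n a (length ν))))

  sum-raise-1 : ∀ ν → sum (raise 1 ν) ≡ length ν + sum ν
  sum-raise-1 ν = trans (sum-raise 1 ν) (cong (_+ sum ν) (*-identityˡ (length ν)))

  data Decomposition : Set where
    lifted runK runA : List ℕ → Decomposition

  assemble : Decomposition → List ℕ
  assemble (lifted ν) = raise 1 ν
  assemble (runK ν) = withRunK ν
  assemble (runA ν) = withRunA ν

  Fits : ℕ → ℕ → ℕ → Decomposition → Set
  Fits s l n (lifted ν) = T (l ≤ᵇ n) × IsAscD s l (n ∸ l) ν
  Fits s l n (runK ν) = T (k ≤ᵇ l) × T (weightK l ≤ᵇ n) × IsAscD s (l ∸ k) (n ∸ weightK l) ν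
  Fits s l n (runA ν) = T (1 ≤ᵇ s) × T (a ≤ᵇ l) × T (weightA l ≤ᵇ n) × IsAscD (s ∸ 1) (l ∸ a) (n ∸ weightA l) ν

  Fits-irrelevant : ∀ {s l n} d (p q : Fits s l n d) → p ≡ q
  Fits-irrelevant (lifted ν) (g , ok) (g′ , ok′) = cong₂ _,_ (T-irrelevant g g′) (IsAscD-irrelevant ok ok′)
  Fits-irrelevant (runK ν) (g₁ , g₂ , ok) (g₁′ , g₂′ , ok′) =
    cong₂ _,_ (T-irrelevant g₁ g₁′) (cong₂ _,_ (T-irrelevant g₂ g₂′) (IsAscD-irrelevant ok ok′))
  Fits-irrelevant (runA ν) (g₁ , g₂ , g₃ , ok) (g₁′ , g₂′ , g₃′ , ok′) =
    cong₂ _,_ (T-irrelevant g₁ g₁′)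
      (cong₂ _,_ (T-irrelevant g₂ g₂′) (cong₂ _,_ (T-irrelevant g₃ g₃′) (IsAscD-irrelevant ok ok′)))

  split-+ : ∀ {c x n} → c + x ≡ n → T (c ≤ᵇ n) × x ≡ n ∸ c
  split-+ {c} {x} refl = ≤⇒≤ᵇ (m≤m+n c x) , sym (m+n∸m≡n c x)

  join-+ : ∀ {c x n} → T (c ≤ᵇ n) → x ≡ n ∸ c → c + x ≡ n
  join-+ {c} {n = n} c≤n refl = m+[n∸m]≡n (≤ᵇ⇒≤ c n c≤n)

  fits-assemble : ∀ {s l n} d → Fits s l n d → IsAscD s l n (assemble d)
  fits-assemble {s} {l} {n} (lifted ν) (l≤n , asc , adm , sl≡ , len≡ , sum≡) =
    Ascending-weaken z≤n (Ascending-raise₀ 1 ν asc) ,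
    subst T (cong (allᵇ residue0orA) (sym (ascRuns-raise 1 ν))) adm ,
    trans (cong (count residueA) (ascRuns-raise 1 ν)) sl≡ ,
    trans (length-map _ ν) len≡ ,
    trans (sum-raise-1 ν) (trans (cong (_+ sum ν) len≡) (join-+ l≤n sum≡))
  fits-assemble {s} {l} {n} (runK ν) (k≤l , w≤n , asc , adm , sl≡ , len≡ , sum≡) =
    Ascending-consecutive 0 k (raise k ν) (Ascending-raise₀ k ν asc) ,
    subst T (sym (allᵇ-withRunK ν)) adm ,
    trans (count-withRunK ν) sl≡ ,
    trans (length-withRunK ν) k+len≡l ,
    trans (sum-withRunK ν) (trans (cong (λ z → weightK z + sum ν) k+len≡l) (join-+ w≤n sum≡))
    where k+len≡l = join-+ k≤l len≡
  fits-assemble {suc s} {l} {n} (runA ν) (_ , a≤l , w≤n , asc , adm , sl≡ , len≡ , sum≡) =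
    Ascending-consecutive 0 a (raise (suc a) ν) (Ascending-weaken (n≤1+n a) (Ascending-raise₀ (suc a) ν asc)) ,
    subst T (sym (allᵇ-withRunA ν asc)) adm ,
    trans (count-withRunA ν asc) (cong suc sl≡) ,
    trans (length-withRunA ν) a+len≡l ,
    trans (sum-withRunA ν) (trans (cong (λ z → weightA z + sum ν) a+len≡l) (join-+ w≤n sum≡))
    where a+len≡l = join-+ a≤l len≡

  lifted-fits : ∀ {s l n ν} → IsAscD s l n (raise 1 ν) → Ascending 0 ν → Fits s l n (lifted ν)
  lifted-fits {ν = ν} (_ , adm , sl≡ , len≡ , sum≡) asc =
    proj₁ n-split , asc , subst T (cong (allᵇ residue0orA) (ascRuns-raise 1 ν)) adm ,
    trans (cong (count residueA) (sym (ascRuns-raise 1 ν))) sl≡ , len , proj₂ n-split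
    where
    len = trans (sym (length-map _ ν)) len≡
    n-split = split-+ (trans (cong (_+ sum ν) (sym len)) (trans (sym (sum-raise-1 ν)) sum≡))

  runK-fits : ∀ {s l n ν} → IsAscD s l n (withRunK ν) → Ascending 0 ν → Fits s l n (runK ν)
  runK-fits {ν = ν} (_ , adm , sl≡ , len≡ , sum≡) asc =
    proj₁ l-split , proj₁ n-split , asc , subst T (allᵇ-withRunK ν) adm , trans (sym (count-withRunK ν)) sl≡ ,
    proj₂ l-split , proj₂ n-split
    where
    k+len≡l = trans (sym (length-withRunK ν)) len≡
    l-split = split-+ k+len≡l
    n-split = split-+ (trans (cong (λ z → weightK z + sum ν) (sym k+len≡l)) (trans (sym (sum-withRunK ν)) sum≡))

  runA-fits : ∀ {s l n ν} → IsAscD s l n (withRunA ν) → Ascending 0 ν → Fits s l n (runA ν)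
  runA-fits {ν = ν} (_ , adm , sl≡ , len≡ , sum≡) asc =
    proj₁ s-split , proj₁ l-split , proj₁ n-split , asc ,
    subst T (allᵇ-withRunA ν asc) adm ,
    proj₂ s-split , proj₂ l-split , proj₂ n-split
    where
    a+len≡l = trans (sym (length-withRunA ν)) len≡
    l-split = split-+ a+len≡l
    n-split = split-+ (trans (cong (λ z → weightA z + sum ν) (sym a+len≡l)) (trans (sym (sum-withRunA ν)) sum≡))
    s-split = split-+ (trans (sym (count-withRunA ν asc)) sl≡)

  decompose : List ℕ → Decomposition
  decompose ρ =
    if initialRun 0 ρ ≡ᵇ 0 then lifted (lower 1 ρ)
    else if initialRun 0 ρ ≡ᵇ a then runA (lower (suc a) (drop a ρ))
    else runK (lower k (drop k ρ))

  k≤initialRun : ∀ {s l n ρ} → IsAscD s l n ρ → initialRun 0 ρ ≢ 0 → initialRun 0 ρ ≢ a → k ≤ initialRun 0 ρ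
  k≤initialRun {ρ = ρ} (asc , adm , _) run≢0 run≢a with initialRun 0 ρ in run≡ | k ≤? initialRun 0 ρ
  ... | zero | _ = contradiction refl run≢0
  ... | suc r′ | yes k≤r = k≤r
  ... | suc r′ | no k≰r with Equivalence.to T-∨ (subst T residue0orA-r≡ first-admissible)
    where
    first-admissible : T (residue0orA (suc r′))
    first-admissible = proj₁ (Equivalence.to T-∧ (subst (T ∘ allᵇ residue0orA) (ascRuns-initialRun r′ ρ run≡ asc) adm))
    residue0orA-r≡ : residue0orA (suc r′) ≡ (suc r′ ≡ᵇ 0) ∨ (suc r′ ≡ᵇ a)
    residue0orA-r≡ = cong₂ (λ x y → (x ≡ᵇ 0) ∨ (x ≡ᵇ y)) (m<n⇒m%n≡m (≰⇒> k≰r)) a%k≡a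
  ...   | inj₁ ()
  ...   | inj₂ r≡a = contradiction (≡ᵇ⇒≡ _ a r≡a) run≢a

  Recovers : ℕ → ℕ → ℕ → List ℕ → Decomposition → Set
  Recovers s l n ρ d = assemble d ≡ ρ × Fits s l n d

  decompose-spec : ∀ {s l n ρ} → IsAscD s l n ρ → Recovers s l n ρ (decompose ρ)
  decompose-spec {s} {l} {n} {ρ} ok@(asc , _) with initialRun 0 ρ ≟ 0
  ... | yes run≡0 = subst (Recovers s l n ρ) (sym (if-true (≡⇒≡ᵇ _ 0 run≡0)))
                          (ρ≡ , lifted-fits (subst (IsAscD s l n) (sym ρ≡) ok) ascν)
    where
    ν-split = raise-lower-Ascending 1 ρ (proj₂ (prefix-split-exact 0 ρ run≡0 asc))
    ρ≡ = proj₁ ν-split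
    ascν = proj₂ ν-split
  ... | no run≢0 with initialRun 0 ρ ≟ a
  ...   | yes run≡a = subst (Recovers s l n ρ)
                            (sym (trans (if-false (run≢0 ∘ ≡ᵇ⇒≡ _ 0)) (if-true (≡⇒≡ᵇ _ a run≡a))))
                            (ρ≡ , runA-fits (subst (IsAscD s l n) (sym ρ≡) ok) ascν)
    where
    X-split = prefix-split-exact a ρ run≡a asc
    ν-split = raise-lower-Ascending (suc a) (drop a ρ) (proj₂ X-split)
    ρ≡ = trans (cong (consecutive 0 a ++_) (proj₁ ν-split)) (sym (proj₁ X-split))
    ascν = proj₂ ν-split
  ...   | no run≢a = subst (Recovers s l n ρ)
                           (sym (trans (if-false (run≢0 ∘ ≡ᵇ⇒≡ _ 0)) (if-false (run≢a ∘ ≡ᵇ⇒≡ _ a))))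
                           (ρ≡ , runK-fits (subst (IsAscD s l n) (sym ρ≡) ok) ascν)
    where
    X-split = prefix-split k ρ (k≤initialRun ok run≢0 run≢a) asc
    ν-split = raise-lower-Ascending k (drop k ρ) (proj₂ X-split)
    ρ≡ = trans (cong (consecutive 0 k ++_) (proj₁ ν-split)) (sym (proj₁ X-split))
    ascν = proj₂ ν-split

  decompose-assemble : ∀ {s l n} d → Fits s l n d → decompose (assemble d) ≡ d
  decompose-assemble (lifted ν) (_ , asc , _) = begin
    decompose (raise 1 ν)                ≡⟨ if-true (≡⇒≡ᵇ _ 0 (initialRun-raise 0 ν asc)) ⟩
    lifted (lower 1 (raise 1 ν))         ≡⟨ cong lifted (lower-raise 1 ν) ⟩
    lifted ν                             ∎
  decompose-assemble (runK ν) (_ , _ , asc , _) = begin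
    decompose (withRunK ν)
      ≡⟨ if-false {x = lifted (lower 1 (withRunK ν))} (<⇒≢ (<-≤-trans z<s k≤run) ∘ sym ∘ ≡ᵇ⇒≡ run 0) ⟩
    (if run ≡ᵇ a then runA (lower (suc a) (drop a (withRunK ν))) else runK (lower k (drop k (withRunK ν))))
      ≡⟨ if-false (<⇒≢ (<-≤-trans a<k k≤run) ∘ sym ∘ ≡ᵇ⇒≡ run a) ⟩
    runK (lower k (drop k (withRunK ν)))
      ≡⟨ cong (runK ∘ lower k) (drop-consecutive 0 k (raise k ν)) ⟩
    runK (lower k (raise k ν))
      ≡⟨ cong runK (lower-raise k ν) ⟩
    runK ν ∎
    where
    run = initialRun 0 (withRunK ν)
    k≤run : k ≤ run
    k≤run = subst (k ≤_) (sym (initialRun-consecutive 0 k (raise k ν))) (m≤m+n k _)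
  decompose-assemble (runA ν) (_ , _ , _ , asc , _) = begin
    decompose (withRunA ν)
      ≡⟨ if-false {x = lifted (lower 1 (withRunA ν))} (λ eq → 1+n≢0 (trans (sym run≡a) (≡ᵇ⇒≡ run 0 eq))) ⟩
    (if run ≡ᵇ a then runA (lower (suc a) (drop a (withRunA ν))) else runK (lower k (drop k (withRunA ν))))
      ≡⟨ if-true (≡⇒≡ᵇ _ a run≡a) ⟩
    runA (lower (suc a) (drop a (withRunA ν)))
      ≡⟨ cong (runA ∘ lower (suc a)) (drop-consecutive 0 a (raise (suc a) ν)) ⟩
    runA (lower (suc a) (raise (suc a) ν))
      ≡⟨ cong runA (lower-raise (suc a) ν) ⟩
    runA ν ∎
    where
    run = initialRun 0 (withRunA ν)
    run≡a : run ≡ a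
    run≡a = trans (initialRun-consecutive 0 a (raise (suc a) ν))
                  (trans (cong (λ z → a + z) (initialRun-raise a ν asc)) (+-identityʳ a))

  AscD↔Fits : ∀ s l n → AscD s l n ↔ Σ Decomposition (Fits s l n)
  AscD↔Fits s l n = mk↔ₛ′ to from to∘from from∘to
    where
    to : AscD s l n → Σ Decomposition (Fits s l n)
    to (ρ , ok) = decompose ρ , proj₂ (decompose-spec ok)
    from : Σ Decomposition (Fits s l n) → AscD s l n
    from (d , fits) = assemble d , fits-assemble d fits
    to∘from : ∀ x → to (from x) ≡ x
    to∘from (d , fits) = Fits-≡ (decompose-assemble d fits) _ fits
      where
      Fits-≡ : ∀ {d d′} → d ≡ d′ → (p : Fits s l n d) (q : Fits s l n d′) →
               _≡_ {A = Σ Decomposition (Fits s l n)} (d , p) (d′ , q)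
      Fits-≡ {d} refl p q = cong (d ,_) (Fits-irrelevant d p q)
    from∘to : ∀ x → from (to x) ≡ x
    from∘to (ρ , ok) = AscD-≡ (proj₁ (decompose-spec ok)) _ ok

  Pieces : ℕ → ℕ → ℕ → Set
  Pieces s l n =
      (T (l ≤ᵇ n) × AscD s l (n ∸ l))
    ⊎ (T (k ≤ᵇ l) × T (weightK l ≤ᵇ n) × AscD s (l ∸ k) (n ∸ weightK l))
    ⊎ (T (1 ≤ᵇ s) × T (a ≤ᵇ l) × T (weightA l ≤ᵇ n) × AscD (s ∸ 1) (l ∸ a) (n ∸ weightA l))

  Fits↔Pieces : ∀ s l n → Σ Decomposition (Fits s l n) ↔ Pieces s l n
  Fits↔Pieces s l n = mk↔ₛ′ to from to∘from from∘to
    where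
    to : Σ Decomposition (Fits s l n) → Pieces s l n
    to (lifted ν , g , ok) = inj₁ (g , ν , ok)
    to (runK ν , g₁ , g₂ , ok) = inj₂ (inj₁ (g₁ , g₂ , ν , ok))
    to (runA ν , g₁ , g₂ , g₃ , ok) = inj₂ (inj₂ (g₁ , g₂ , g₃ , ν , ok))
    from : Pieces s l n → Σ Decomposition (Fits s l n)
    from (inj₁ (g , ν , ok)) = lifted ν , g , ok
    from (inj₂ (inj₁ (g₁ , g₂ , ν , ok))) = runK ν , g₁ , g₂ , ok
    from (inj₂ (inj₂ (g₁ , g₂ , g₃ , ν , ok))) = runA ν , g₁ , g₂ , g₃ , ok
    to∘from : ∀ x → to (from x) ≡ x
    to∘from (inj₁ _) = refl
    to∘from (inj₂ (inj₁ _)) = refl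
    to∘from (inj₂ (inj₂ _)) = refl
    from∘to : ∀ x → from (to x) ≡ x
    from∘to (lifted _ , _) = refl
    from∘to (runK _ , _) = refl
    from∘to (runA _ , _) = refl

  AscD-length-0 : ∀ {s n} → AscD s 0 n → s ≡ 0 × n ≡ 0
  AscD-length-0 ([] , _ , _ , sl≡ , _ , sum≡) = sym sl≡ , sym sum≡

-- Counting

Counts : ℤ → Set → Set
Counts c X = Σ ℕ λ N → (+ N ≡ c) × (Fin N ↔ X)

Counts-↔ : ∀ {c X Y} → X ↔ Y → Counts c X → Counts c Y
Counts-↔ X↔Y (N , N≡c , N↔X) = N , N≡c , ↔-trans N↔X X↔Y

Counts-≡ : ∀ {c d X} → c ≡ d → Counts c X → Counts d X
Counts-≡ refl cnt = cnt

Counts-⊎ : ∀ {c d X Y} → Counts c X → Counts d Y → Counts (c +ℤ d) (X ⊎ Y)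
Counts-⊎ (M , refl , M↔X) (N , refl , N↔Y) = M + N , refl , ↔-trans +↔⊎ (M↔X ⊎-↔ N↔Y)

Counts-empty : ∀ {X} → ¬ X → Counts (+ 0) X
Counts-empty ¬x = 0 , refl , mk↔ₛ′ (λ ()) (⊥-elim ∘ ¬x) (⊥-elim ∘ ¬x) (λ ())

Counts-singleton : ∀ {X} (x : X) → (∀ y → y ≡ x) → Counts (+ 1) X
Counts-singleton x unique = 1 , refl , mk↔ₛ′ (λ _ → x) (λ _ → zero) (sym ∘ unique) (λ { zero → refl })

Counts-if : ∀ b {c X} → (T b → Counts c X) → Counts (if b then c else + 0) (T b × X)
Counts-if true cnt = Counts-↔ (mk↔ₛ′ (_ ,_) proj₂ (λ _ → refl) (λ _ → refl)) (cnt _)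
Counts-if false _ = Counts-empty proj₁

0<triangle-suc : ∀ c → 0 < triangle (suc c)
0<triangle-suc c = subst (0 <_) (sym (triangle-suc c)) z<s

∸-< : ∀ {c n} → 0 < c → T (c ≤ᵇ n) → n ∸ c < n
∸-< {suc c} {n} _ c≤n = ∸-monoʳ-< {n} z<s (≤ᵇ⇒≤ (suc c) n c≤n)

module Counting (a′ k′ : ℕ) (a<k : suc a′ < suc k′) where

  open RightHandSide a′ k′
  open Partitions a′ k′ a<k

  counts-base : ∀ s n → Counts (rhs s 0 n) (AscD s 0 n)
  counts-base zero zero = Counts-≡ (sym (rhs-0-0 0)) (Counts-singleton ([] , [-] , _ , refl , refl , refl) only-[])
    where
    only-[] : ∀ y → y ≡ ([] , [-] , _ , refl , refl , refl)
    only-[] ([] , ok) = AscD-≡ refl ok _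
    only-[] (_ ∷ _ , _ , _ , _ , () , _)
  counts-base zero (suc n) = Counts-≡ (sym (rhs-0-0 (suc n))) (Counts-empty (1+n≢0 ∘ proj₂ ∘ AscD-length-0))
  counts-base (suc s) n = Counts-≡ (sym (rhs-suc-0 s n)) (Counts-empty (1+n≢0 ∘ proj₁ ∘ AscD-length-0))

  counts : ∀ n s l → Counts (rhs s l n) (AscD s l n)
  counts = <-rec (λ n → ∀ s l → Counts (rhs s l n) (AscD s l n)) step
    where
    step : ∀ n → (∀ {m} → m < n → ∀ s l → Counts (rhs s l m) (AscD s l m)) → ∀ s l → Counts (rhs s l n) (AscD s l n)
    step n _ s zero = counts-base s n
    step n ih s l@(suc l′) =
      Counts-≡ (sym (rhs-rec s l′ n)) (Counts-↔ (↔-sym (↔-trans (AscD↔Fits s l n) (Fits↔Pieces s l n)))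
        (Counts-⊎ (Counts-if (l ≤ᵇ n) λ l≤n →
                     ih (∸-< z<s l≤n) s l)
        (Counts-⊎ (Counts-if (k ≤ᵇ l) λ _ → Counts-if (weightK l ≤ᵇ n) λ w≤n →
                     ih (∸-< 0<weightK w≤n) s (l ∸ k))
                  (Counts-if (1 ≤ᵇ s) λ _ → Counts-if (a ≤ᵇ l) λ _ → Counts-if (weightA l ≤ᵇ n) λ w≤n →
                     ih (∸-< 0<weightA w≤n) (s ∸ 1) (l ∸ a)))))
      where
      0<weightK : 0 < weightK l
      0<weightK = <-≤-trans (0<triangle-suc k′) (m≤n+m _ _)
      0<weightA : 0 < weightA l
      0<weightA = <-≤-trans (0<triangle-suc a′) (m≤n+m _ _)

theorem5p1 : (k a : ℕ) .{{_ : NonZero k}} → 1 ≤ a → a < k → (s l n : ℕ) →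
    Σ ℕ (λ N → (+ N ≡ rhsCoeff k a s l n) × (Fin N ↔ DPart k a s l n))
theorem5p1 (suc k′) (suc a′) (s≤s z≤n) a<k s l n =
  Counts-↔ (↔-sym (DPart↔AscD s l n)) (counts n s l)
  where
  open Partitions a′ k′ a<k using (DPart↔AscD)
  open Counting a′ k′ a<k using (counts)
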